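{- Suppose $n\geq 3$. Then there are exactly $2^{n-3}$ $2$-chains of size $n$ up to isomorphism.
   Context: All posets are finite; partial orders are written $\preceq$. A poset $(P,\preceq)$ is a $2$-chain if (1) there is a unique way to write $P$ as the (set) union of two chains, and (2) $\preceq$ is maximal subject to (1), i.e. for every proper refinement $\preceq^+$ of $\preceq$ (a partial order with $p\preceq^+q$ whenever $p\preceq q$, and strictly more related pairs) there is more than one way to write $P$ as the union of two $\preceq^+$-chains. -}

module Defs where

open import Data.Nat using (ℕ)
open import Data.Bool using (Bool; T)
open import Data.Fin using (Fin)
open import Data.Fin.Subset using (Subset; _∈_)
open import Data.Fin.Permutation using (Permutation′; _⟨$⟩ʳ_)
open import Data.Product using (Σ; ∃; ∃-syntax; _×_)
open import Data.Sum using (_⊎_)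
open import Relation.Nullary using (¬_)
open import Relation.Binary.PropositionalEquality using (_≡_)
open import Relation.Binary.Structures using (IsPartialOrder)

Rel : ℕ → Set
Rel n = Fin n → Fin n → Bool

Holds : ∀ {n} → Rel n → Fin n → Fin n → Set
Holds R i j = T (R i j)

IsPoset : ∀ {n} → Rel n → Set
IsPoset R = IsPartialOrder _≡_ (Holds R)

IsChain : ∀ {n} → Rel n → Subset n → Set
IsChain {n} R C = ∀ (i j : Fin n) → i ∈ C → j ∈ C → Holds R i j ⊎ Holds R j i

IsTwoChainCover : ∀ {n} → Rel n → Subset n → Subset n → Set
IsTwoChainCover {n} R A B = IsChain R A × IsChain R B × (∀ (i : Fin n) → i ∈ A ⊎ i ∈ B)

SameWay : ∀ {n} → Subset n → Subset n → Subset n → Subset n → Set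
SameWay A B A′ B′ = (A ≡ A′ × B ≡ B′) ⊎ (A ≡ B′ × B ≡ A′)

UniqueTwoChainCover : ∀ {n} → Rel n → Set
UniqueTwoChainCover {n} R =
  (∃[ A ] ∃[ B ] IsTwoChainCover R A B) ×
  (∀ (A B A′ B′ : Subset n) → IsTwoChainCover R A B → IsTwoChainCover R A′ B′ → SameWay A B A′ B′)

SeveralTwoChainCovers : ∀ {n} → Rel n → Set
SeveralTwoChainCovers {n} R =
  Σ (Subset n) λ A → Σ (Subset n) λ B → Σ (Subset n) λ A′ → Σ (Subset n) λ B′ →
    IsTwoChainCover R A B × IsTwoChainCover R A′ B′ × ¬ SameWay A B A′ B′

IsProperRefinement : ∀ {n} → Rel n → Rel n → Set
IsProperRefinement {n} R R⁺ =
  IsPoset R⁺ ×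
  (∀ (i j : Fin n) → Holds R i j → Holds R⁺ i j) ×
  (∃[ i ] ∃[ j ] (Holds R⁺ i j × ¬ Holds R i j))

IsTwoChain : ∀ {n} → Rel n → Set
IsTwoChain {n} R =
  IsPoset R ×
  UniqueTwoChainCover R ×
  (∀ (R⁺ : Rel n) → IsProperRefinement R R⁺ → SeveralTwoChainCovers R⁺)

Isomorphic : ∀ {n} → Rel n → Rel n → Set
Isomorphic {n} R S = Σ (Permutation′ n) λ σ → ∀ (i j : Fin n) → R i j ≡ S (σ ⟨$⟩ʳ i) (σ ⟨$⟩ʳ j)

-- Colour every element of a 2-chain by the chain of its unique cover that contains it. Maximality
-- (adding a comparability always creates a second cover) shows that each element has an incomparable
-- partner, that there is no 2+2, and hence that incomparable elements have nested lower sets; a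
-- recolouring argument then shows that distinct elements of positive down-degree have different
-- down-degrees, and there are exactly two minimal elements. Listing the elements by down-degree
-- therefore identifies the 2-chain with the canonical order of its colour word τ, in which x ≤ y iff
-- x = y or the colour of x recurs in (x, y]. Conversely every canonical order with τ 0 ≠ τ 1 is a
-- 2-chain; its down-degrees are x ↦ x − 1, so an isomorphism between two of them fixes every position
-- ≥ 2, and the two words agree from position 2 on. Normalising the word to begin with 1 0 1 leaves
-- n − 3 free bits.
module Submission where

open import Defs
open import Level using (Level)
open import Data.Bool using (Bool; true; false; not; _xor_; _∨_; _∧_; if_then_else_; T)
import Data.Bool.Properties as 𝔹
open import Data.Empty using (⊥; ⊥-elim)
open import Data.Unit using (tt)
open import Data.Nat as ℕ using (ℕ; zero; suc; _+_; _≤_; _<_; _∸_; _^_; z≤n; s≤s; _<?_; _≤?_)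
open import Data.Nat.Properties
  using (≤-refl; ≤-trans; ≤-antisym; ≤-total; <-≤-trans; ≤-<-trans; <-trans; <-irrefl; <-asym; <⇒≤; <⇒≱;
         ≤⇒≯; ≰⇒>; ≤∧≢⇒<; <-cmp; m≤n⇒m≤1+n; m≤n⇒m<n∨m≡n; ≤-pred; n<1+n; n≤1+n; n≤0⇒n≡0;
         n≢0⇒n>0;
         m≤m+n; m≤n+m; +-monoˡ-<; +-monoʳ-<; +-cancelˡ-<; ∸-monoʳ-<; m+[n∸m]≡n; +-identityʳ; anyUpTo?;
         +-0-commutativeMonoid)
import Data.Nat.Properties as ℕₚ
import Data.Nat.Induction as ℕ
open import Data.Fin as Fin using (Fin; zero; suc; toℕ; fromℕ<; _≟_; punchOut)
open import Data.Fin.Properties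
  using (any?; injective⇒≤; punchOut-injective; <⇒≢; suc-injective; toℕ-injective; toℕ-fromℕ<; toℕ<n)
open import Data.Fin.Induction using (<-wellFounded)
open import Data.Fin.Subset using (Subset; _∈_; _∉_; _⊆_; _∪_; _∩_; ∁; ⁅_⁆)
open import Data.Fin.Subset.Properties
  using (x∈p∪q⁻; x∈p∪q⁺; x∈p∩q⁻; x∈p∩q⁺; x∈⁅x⁆; x∈⁅y⁆⇒x≡y; x∈∁p⇒x∉p; x∉p⇒x∈∁p;
         x≢y⇒x∉⁅y⁆)
open import Data.Fin.Permutation using (Permutation′; _⟨$⟩ʳ_; _⟨$⟩ˡ_; permutation; inverseˡ; inverseʳ)
open import Data.Vec using (Vec; []; _∷_; lookup; tabulate)
open import Data.Vec.Properties
  using (∷-injectiveʳ; lookup∘tabulate; tabulate∘lookup; tabulate-cong; []=⇒lookup; lookup⇒[]=)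
open import Data.List using (List; []; _∷_; map; _++_; length)
open import Data.List.Properties using (length-map; length-++)
open import Data.List.Membership.Propositional using () renaming (_∈_ to _∈ₗ_)
open import Data.List.Membership.Propositional.Properties using (∈-map⁺; ∈-++⁺ˡ; ∈-++⁺ʳ)
open import Data.List.Relation.Unary.All as All using (All; [])
import Data.List.Relation.Unary.All.Properties as All
open import Data.List.Relation.Unary.Any as Any using (Any; here)
import Data.List.Relation.Unary.Any.Properties as Any
open import Data.List.Relation.Unary.AllPairs as AllPairs using (AllPairs; []; _∷_)
import Data.List.Relation.Unary.AllPairs.Properties as AllPairs
open import Data.Product as Σ using (Σ; ∃; _×_; _,_; proj₁; proj₂)
open import Data.Sum as ⊎ using (_⊎_; inj₁; inj₂; [_,_]; [_,_]′)
open import Function using (_∘_; id; _⇔_; mk⇔; Injection; Equivalence)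
open import Function.Properties.Inverse using (↔⇒↣)
open import Induction.WellFounded using (Acc; acc)
open import Relation.Binary using (Tri; tri<; tri≈; tri>)
open import Relation.Binary.Structures using (IsPartialOrder)
open import Relation.Binary.PropositionalEquality
  using (_≡_; _≢_; refl; sym; trans; cong; cong₂; subst; subst₂; isEquivalence; module ≡-Reasoning)
open import Relation.Nullary using (¬_; ¬?; T?; Dec; yes; no; does; contradiction; _×-dec_; _⊎-dec_)
open import Relation.Nullary.Decidable
  using (⌊_⌋; isYes≗does; decidable-stable; dec-true; dec-false; does-⇔; map′; toWitness; fromWitness)
open import Relation.Unary as U using (Pred; Decidable)
open import Relation.Unary.Properties using (_∪?_; ∅?; U?)
open import Algebra.Properties.CommutativeMonoid.Sum +-0-commutativeMonoid using (sum; sum-permute)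

private variable
  n : ℕ
  ℓ ℓ′ : Level
  R : Rel n
  i j u v : Fin n

-- Counting

count : {P : Pred (Fin n) ℓ} → Decidable P → ℕ
count P? = sum (λ i → if does (P? i) then 1 else 0)

count-cong : {P : Pred (Fin n) ℓ} {Q : Pred (Fin n) ℓ′} (P? : Decidable P) (Q? : Decidable Q) →
             (∀ i → P i ⇔ Q i) → count P? ≡ count Q?
count-cong {n = zero} P? Q? P⇔Q = refl
count-cong {n = suc n} P? Q? P⇔Q =
  cong₂ (λ b c → (if b then 1 else 0) + c) (does-⇔ (P⇔Q zero) (P? zero) (Q? zero))
        (count-cong (P? ∘ suc) (Q? ∘ suc) (P⇔Q ∘ suc))

count-permute : {P : Pred (Fin n) ℓ} (P? : Decidable P) (π : Permutation′ n) →
                count (P? ∘ (π ⟨$⟩ʳ_)) ≡ count P?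
count-permute P? π = sym (sum-permute (λ i → if does (P? i) then 1 else 0) π)

count≤n : {P : Pred (Fin n) ℓ} (P? : Decidable P) → count P? ≤ n
count≤n {n = zero} P? = z≤n
count≤n {n = suc n} P? with P? zero
... | yes _ = s≤s (count≤n (P? ∘ suc))
... | no _ = m≤n⇒m≤1+n (count≤n (P? ∘ suc))

count-∅ : {P : Pred (Fin n) ℓ} (P? : Decidable P) → (∀ i → ¬ P i) → count P? ≡ 0
count-∅ {n = zero} P? ∄P = refl
count-∅ {n = suc n} P? ∄P with P? zero
... | yes P0 = contradiction P0 (∄P zero)
... | no _ = count-∅ (P? ∘ suc) (∄P ∘ suc)

count-mono : {P : Pred (Fin n) ℓ} {Q : Pred (Fin n) ℓ′} (P? : Decidable P) (Q? : Decidable Q) →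
             P U.⊆ Q → count P? ≤ count Q?
count-mono {n = zero} P? Q? P⊆Q = z≤n
count-mono {n = suc n} P? Q? P⊆Q with P? zero | Q? zero
... | yes P0 | no ¬Q0 = contradiction (P⊆Q P0) ¬Q0
... | yes _ | yes _ = s≤s (count-mono (P? ∘ suc) (Q? ∘ suc) P⊆Q)
... | no _ | yes _ = m≤n⇒m≤1+n (count-mono (P? ∘ suc) (Q? ∘ suc) P⊆Q)
... | no _ | no _ = count-mono (P? ∘ suc) (Q? ∘ suc) P⊆Q

count-strict : {P : Pred (Fin n) ℓ} {Q : Pred (Fin n) ℓ′} (P? : Decidable P) (Q? : Decidable Q) →
               P U.⊆ Q → Q i → ¬ P i → count P? < count Q?
count-strict {n = suc n} {i = zero} P? Q? P⊆Q Qi ¬Pi with P? zero | Q? zero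
... | yes Pi | _ = contradiction Pi ¬Pi
... | no _ | no ¬Qi = contradiction Qi ¬Qi
... | no _ | yes _ = s≤s (count-mono (P? ∘ suc) (Q? ∘ suc) P⊆Q)
count-strict {n = suc n} {i = suc i} P? Q? P⊆Q Qi ¬Pi with P? zero | Q? zero
... | yes P0 | no ¬Q0 = contradiction (P⊆Q P0) ¬Q0
... | yes _ | yes _ = s≤s (count-strict (P? ∘ suc) (Q? ∘ suc) P⊆Q Qi ¬Pi)
... | no _ | yes _ = m≤n⇒m≤1+n (count-strict (P? ∘ suc) (Q? ∘ suc) P⊆Q Qi ¬Pi)
... | no _ | no _ = count-strict (P? ∘ suc) (Q? ∘ suc) P⊆Q Qi ¬Pi

count-gap : {P : Pred (Fin n) ℓ} {Q : Pred (Fin n) ℓ′} (P? : Decidable P) (Q? : Decidable Q) →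
            count P? < count Q? → ∃ λ i → Q i × ¬ P i
count-gap {n = suc n} P? Q? lt with P? zero | Q? zero
... | no ¬P0 | yes Q0 = zero , Q0 , ¬P0
... | yes _ | yes _ = Σ.map suc id (count-gap (P? ∘ suc) (Q? ∘ suc) (≤-pred lt))
... | no _ | no _ = Σ.map suc id (count-gap (P? ∘ suc) (Q? ∘ suc) lt)
... | yes _ | no _ = Σ.map suc id (count-gap (P? ∘ suc) (Q? ∘ suc) (<⇒≤ lt))

count-two-gaps : {P : Pred (Fin n) ℓ} {Q : Pred (Fin n) ℓ′} (P? : Decidable P) (Q? : Decidable Q) →
                 P U.⊆ Q → i ≢ j → Q i → ¬ P i → Q j → ¬ P j → 2 + count P? ≤ count Q?
count-two-gaps {i = i} P? Q? P⊆Q i≢j Qi ¬Pi Qj ¬Pj =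
  ≤-trans (s≤s (count-strict P? P+i? inj₁ (inj₂ refl) ¬Pi))
          (count-strict P+i? Q? [ P⊆Q , (λ { refl → Qi }) ] Qj [ ¬Pj , i≢j ])
  where
  P+i? = P? ∪? (i ≟_)

count-toℕ< : ∀ k → k ≤ n → count (λ (i : Fin n) → toℕ i <? k) ≡ k
count-toℕ< {n = zero} zero _ = refl
count-toℕ< {n = suc n} zero _ = count-∅ (λ (i : Fin (suc n)) → toℕ i <? 0) (λ i ())
count-toℕ< {n = suc n} (suc k) (s≤s k≤n) =
  cong suc (trans (count-cong (λ (i : Fin n) → suc (toℕ i) <? suc k) (λ i → toℕ i <? k)
                              (λ i → mk⇔ ≤-pred s≤s))
                  (count-toℕ< k k≤n))

private
  count-≢-suc : {P : Pred (Fin (suc n)) ℓ} (P? : Decidable P) (i : Fin n) →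
                count (λ j → P? (suc j) ×-dec ¬? (suc i ≟ suc j)) ≡ count (λ j → P? (suc j) ×-dec ¬? (i ≟ j))
  count-≢-suc P? i = count-cong (λ j → P? (suc j) ×-dec ¬? (suc i ≟ suc j)) (λ j → P? (suc j) ×-dec ¬? (i ≟ j))
                                (λ j → mk⇔ (Σ.map₂ (_∘ cong suc)) (Σ.map₂ (_∘ suc-injective)))

count-remove : {P : Pred (Fin n) ℓ} (P? : Decidable P) → P i →
               count P? ≡ suc (count (λ j → P? j ×-dec ¬? (i ≟ j)))
count-remove {n = suc n} {i = zero} P? P0 with P? zero
... | no ¬P0 = contradiction P0 ¬P0
... | yes _ =
  cong suc (count-cong (P? ∘ suc) (λ j → P? (suc j) ×-dec ¬? (zero ≟ suc j)) (λ j → mk⇔ (_, λ ()) proj₁))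
count-remove {n = suc n} {i = suc i} P? Pi with P? zero
... | yes _ = cong suc (trans (count-remove (P? ∘ suc) Pi) (cong suc (count-≢-suc P? i)))
... | no _ = trans (count-remove (P? ∘ suc) Pi) (cong suc (count-≢-suc P? i))

-- Chains and covers

Comparable : Rel n → Fin n → Fin n → Set
Comparable R i j = Holds R i j ⊎ Holds R j i

Incomparable : Rel n → Fin n → Fin n → Set
Incomparable R i j = ¬ Holds R i j × ¬ Holds R j i

Strict : Rel n → Fin n → Fin n → Set
Strict R i j = Holds R i j × i ≢ j

strict? : (R : Rel n) → ∀ i j → Dec (Strict R i j)
strict? R i j = T? (R i j) ×-dec ¬? (i ≟ j)

downDegree : Rel n → Fin n → ℕ
downDegree R z = count (λ w → strict? R w z)

incomparable-sym : Incomparable R i j → Incomparable R j i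
incomparable-sym (i⋠j , j⋠i) = j⋠i , i⋠j

incomparable⇒¬comparable : Incomparable R i j → ¬ Comparable R i j
incomparable⇒¬comparable (i⋠j , j⋠i) = [ i⋠j , j⋠i ]

mkIsPoset : (R : Rel n) → (∀ i → Holds R i i) →
            (∀ {i j k} → Holds R i j → Holds R j k → Holds R i k) →
            (∀ {i j} → Holds R i j → Holds R j i → i ≡ j) → IsPoset R
mkIsPoset R refl′ trans′ antisym′ = record
  { isPreorder = record
    { isEquivalence = isEquivalence
    ; reflexive = λ { {i} refl → refl′ i }
    ; trans = trans′
    }
  ; antisym = antisym′
  }

chain-⊆ : {A C : Subset n} → A ⊆ C → IsChain R C → IsChain R A
chain-⊆ A⊆C chain i j i∈A j∈A = chain i j (A⊆C i∈A) (A⊆C j∈A)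

chain-incomparable : {C : Subset n} → IsChain R C → Incomparable R u v → u ∈ C → v ∉ C
chain-incomparable {R = R} chain u∥v u∈C v∈C = incomparable⇒¬comparable {R = R} u∥v (chain _ _ u∈C v∈C)

swap-cover : {A B : Subset n} → IsTwoChainCover R A B → IsTwoChainCover R B A
swap-cover (chainA , chainB , covers) = chainB , chainA , ⊎.swap ∘ covers

SameWay-sym : {A B A′ B′ : Subset n} → SameWay A B A′ B′ → SameWay A′ B′ A B
SameWay-sym = ⊎.map (Σ.map sym sym) (Σ.map sym sym ∘ Σ.swap)

SameWay-trans : {A B A′ B′ A″ B″ : Subset n} →
                SameWay A B A′ B′ → SameWay A′ B′ A″ B″ → SameWay A B A″ B″
SameWay-trans (inj₁ (p , q)) (inj₁ (r , s)) = inj₁ (trans p r , trans q s)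
SameWay-trans (inj₁ (p , q)) (inj₂ (r , s)) = inj₂ (trans p r , trans q s)
SameWay-trans (inj₂ (p , q)) (inj₁ (r , s)) = inj₂ (trans p s , trans q r)
SameWay-trans (inj₂ (p , q)) (inj₂ (r , s)) = inj₁ (trans p s , trans q r)

unique⇒¬several : UniqueTwoChainCover R → ¬ SeveralTwoChainCovers R
unique⇒¬several (_ , same) (A , B , A′ , B′ , cover , cover′ , different) =
  different (same A B A′ B′ cover cover′)

lookup-∉ : {A : Subset n} → i ∉ A → lookup A i ≡ false
lookup-∉ {i = i} {A = A} i∉A = 𝔹.¬-not (i∉A ∘ lookup⇒[]= i A)

≡-tabulate : {A : Subset n} {f : Fin n → Bool} → (∀ i → lookup A i ≡ f i) → A ≡ tabulate f
≡-tabulate {A = A} A≗f = trans (sym (tabulate∘lookup A)) (tabulate-cong A≗f)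

tabulate-≡⇒lookup : (f : Fin n → Bool) {A : Subset n} → tabulate f ≡ A → ∀ k → lookup A k ≡ f k
tabulate-≡⇒lookup f refl k = lookup∘tabulate f k

∈-tabulate⁺ : (f : Fin n → Bool) → f i ≡ true → i ∈ tabulate f
∈-tabulate⁺ {i = i} f fi = lookup⇒[]= i (tabulate f) (trans (lookup∘tabulate f i) fi)

∈-tabulate⁻ : (f : Fin n → Bool) → i ∈ tabulate f → f i ≡ true
∈-tabulate⁻ {i = i} f i∈f = trans (sym (lookup∘tabulate f i)) ([]=⇒lookup i∈f)

colourCover : (f : Fin n → Bool) → (∀ i j → f i ≡ f j → Comparable R i j) →
              IsTwoChainCover R (tabulate f) (tabulate (not ∘ f))
colourCover {R = R} f monochromatic = chainT , chainF , covers
  where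
  chainT : IsChain R (tabulate f)
  chainT i j i∈ j∈ = monochromatic i j (trans (∈-tabulate⁻ f i∈) (sym (∈-tabulate⁻ f j∈)))
  chainF : IsChain R (tabulate (not ∘ f))
  chainF i j i∈ j∈ =
    monochromatic i j (𝔹.not-injective (trans (∈-tabulate⁻ (not ∘ f) i∈) (sym (∈-tabulate⁻ (not ∘ f) j∈))))
  covers : ∀ i → i ∈ tabulate f ⊎ i ∈ tabulate (not ∘ f)
  covers i with f i in fi
  ... | true = inj₁ (∈-tabulate⁺ f fi)
  ... | false = inj₂ (∈-tabulate⁺ (not ∘ f) (cong not fi))

module _ {R : Rel n} {A B : Subset n} (cover : IsTwoChainCover R A B) where

  private
    chainA = proj₁ cover
    chainB = proj₁ (proj₂ cover)
    covers = proj₂ (proj₂ cover)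

  cover-separates : Incomparable R u v → u ∈ A → v ∈ B
  cover-separates {v = v} u∥v u∈A =
    [ (λ v∈A → contradiction v∈A (chain-incomparable {R = R} chainA u∥v u∈A)) , id ]′ (covers v)

  cover-colour-flips : Incomparable R u v → lookup A v ≡ not (lookup A u)
  cover-colour-flips {u = u} {v = v} u∥v with lookup A u in Au
  ... | true = lookup-∉ (chain-incomparable {R = R} chainA u∥v (lookup⇒[]= u A Au))
  ... | false with covers u
  ...   | inj₁ u∈A = contradiction (trans (sym ([]=⇒lookup u∈A)) Au) λ ()
  ...   | inj₂ u∈B =
    []=⇒lookup ([ id , (λ v∈B → contradiction v∈B (chain-incomparable {R = R} chainB u∥v u∈B)) ]′ (covers v))

  cover-complement : Incomparable R u v → lookup B u ≡ not (lookup A u)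
  cover-complement {u = u} u∥v with lookup A u in Au
  ... | true = lookup-∉ (chain-incomparable {R = R} chainB (incomparable-sym {R = R} u∥v)
                                             (cover-separates u∥v (lookup⇒[]= u A Au)))
  ... | false = []=⇒lookup ([ (λ u∈A → contradiction (trans (sym ([]=⇒lookup u∈A)) Au) λ ()) , id ]′ (covers u))

module _ {R : Rel n} {z : Fin n} (comparable : ∀ w → Comparable R z w) where

  chain-∪-⁅⁆ : {C : Subset n} → IsChain R C → IsChain R (C ∪ ⁅ z ⁆)
  chain-∪-⁅⁆ {C = C} chain i j i∈ j∈ with x∈p∪q⁻ C ⁅ z ⁆ i∈ | x∈p∪q⁻ C ⁅ z ⁆ j∈
  ... | inj₁ i∈C | inj₁ j∈C = chain i j i∈C j∈C
  ... | inj₂ i∈z | _ rewrite x∈⁅y⁆⇒x≡y z i∈z = comparable j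
  ... | inj₁ _ | inj₂ j∈z rewrite x∈⁅y⁆⇒x≡y z j∈z = ⊎.swap (comparable i)

  comparable-to-all⇒several : {A B : Subset n} → IsTwoChainCover R A B → SeveralTwoChainCovers R
  comparable-to-all⇒several {A = A} {B = B} (chainA , chainB , covers) =
    A ∪ ⁅ z ⁆ , B ∩ ∁ ⁅ z ⁆ , A ∪ ⁅ z ⁆ , B ∪ ⁅ z ⁆ ,
    (chain-∪-⁅⁆ chainA , chain-⊆ (proj₁ ∘ x∈p∩q⁻ B (∁ ⁅ z ⁆)) chainB , covers-without-z) ,
    (chain-∪-⁅⁆ chainA , chain-∪-⁅⁆ chainB ,
     ⊎.map (x∈p∪q⁺ ∘ inj₁) (x∈p∪q⁺ ∘ inj₁) ∘ covers) ,
    different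
    where
    z∈ : ∀ C → z ∈ C ∪ ⁅ z ⁆
    z∈ C = x∈p∪q⁺ (inj₂ (x∈⁅x⁆ z))
    z∉ : z ∉ B ∩ ∁ ⁅ z ⁆
    z∉ z∈B∖z = x∈∁p⇒x∉p (proj₂ (x∈p∩q⁻ B (∁ ⁅ z ⁆) z∈B∖z)) (x∈⁅x⁆ z)
    covers-without-z : ∀ i → i ∈ A ∪ ⁅ z ⁆ ⊎ i ∈ B ∩ ∁ ⁅ z ⁆
    covers-without-z i with i ≟ z | covers i
    ... | yes refl | _ = inj₁ (z∈ A)
    ... | no _ | inj₁ i∈A = inj₁ (x∈p∪q⁺ (inj₁ i∈A))
    ... | no i≢z | inj₂ i∈B = inj₂ (x∈p∩q⁺ (i∈B , x∉p⇒x∈∁p (x≢y⇒x∉⁅y⁆ i≢z)))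
    different : ¬ SameWay (A ∪ ⁅ z ⁆) (B ∩ ∁ ⁅ z ⁆) (A ∪ ⁅ z ⁆) (B ∪ ⁅ z ⁆)
    different (inj₁ (_ , e)) = z∉ (subst (z ∈_) (sym e) (z∈ B))
    different (inj₂ (_ , e)) = z∉ (subst (z ∈_) (sym e) (z∈ A))

permutation-injective : (σ : Permutation′ n) → σ ⟨$⟩ʳ i ≡ σ ⟨$⟩ʳ j → i ≡ j
permutation-injective σ = Injection.injective (↔⇒↣ σ)

injective⇒surjective : (f : Fin n → Fin n) → (∀ {i j} → f i ≡ f j → i ≡ j) → ∀ k → ∃ λ i → f i ≡ k
injective⇒surjective {n = suc m} f f-injective k with any? (λ i → f i ≟ k)
... | yes hit = hit
... | no miss =
  contradiction (injective⇒≤ {f = skip-k} λ {i} {j} → f-injective ∘ punchOut-injective (k≢f i) (k≢f j))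
                (<-irrefl refl)
  where
  k≢f : ∀ i → k ≢ f i
  k≢f i k≡fi = miss (i , sym k≡fi)
  skip-k : Fin (suc m) → Fin m
  skip-k i = punchOut (k≢f i)

injection⇒permutation : (f : Fin n → Fin n) → (∀ {i j} → f i ≡ f j → i ≡ j) →
                        Σ (Permutation′ n) λ σ → ∀ i → σ ⟨$⟩ʳ i ≡ f i
injection⇒permutation f f-injective =
  permutation f (proj₁ ∘ onto) (proj₂ ∘ onto) (λ i → f-injective (proj₂ (onto (f i)))) , λ _ → refl
  where onto = injective⇒surjective f f-injective

downDegree-invariant : (R R′ : Rel n) ((σ , _) : Isomorphic R R′) →
                       ∀ z → downDegree R z ≡ downDegree R′ (σ ⟨$⟩ʳ z)
downDegree-invariant R R′ (σ , σ-iso) z = trans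
  (count-cong (λ w → strict? R w z) (λ w → strict? R′ (σ ⟨$⟩ʳ w) (σ ⟨$⟩ʳ z))
              (λ w → mk⇔ (Σ.map (subst T (σ-iso w z)) (_∘ permutation-injective σ))
                         (Σ.map (subst T (sym (σ-iso w z))) (_∘ cong (σ ⟨$⟩ʳ_)))))
  (count-permute (λ w → strict? R′ w (σ ⟨$⟩ʳ z)) σ)

xor-cancelʳ : ∀ a b → (a xor b) xor b ≡ a
xor-cancelʳ a b = trans (𝔹.xor-assoc a b b) (trans (cong (a xor_) (𝔹.xor-same b)) (𝔹.xor-identityʳ a))

not-xor-not : ∀ a b → not a xor not b ≡ a xor b
not-xor-not a b = begin
  not a xor not b     ≡⟨ 𝔹.not-distribˡ-xor a (not b) ⟨
  not (a xor not b)   ≡⟨ cong not (𝔹.not-distribʳ-xor a b) ⟨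
  not (not (a xor b)) ≡⟨ 𝔹.not-involutive (a xor b) ⟩
  a xor b             ∎
  where open ≡-Reasoning

xor-flip⇒≢ : ∀ a c {b} → a xor c ≡ b xor not c → a ≢ b
xor-flip⇒≢ false c e refl = 𝔹.not-¬ refl e
xor-flip⇒≢ true c e refl = 𝔹.not-¬ refl e

does-≟-injective : ∀ {a b c} → does (a 𝔹.≟ c) ≡ does (b 𝔹.≟ c) → a ≡ b
does-≟-injective {false} {false} _ = refl
does-≟-injective {true} {true} _ = refl
does-≟-injective {false} {true} {false} ()
does-≟-injective {false} {true} {true} ()
does-≟-injective {true} {false} {false} ()
does-≟-injective {true} {false} {true} ()

does-≟-not : ∀ a c → does (a 𝔹.≟ c) ≢ does (not a 𝔹.≟ c)
does-≟-not false false ()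
does-≟-not false true ()
does-≟-not true false ()
does-≟-not true true ()

-- Canonical orders

_≼[_]_ : ℕ → (ℕ → Bool) → ℕ → Set
x ≼[ τ ] y = x ≡ y ⊎ ∃ λ z → x < z × z ≤ y × τ z ≡ τ x

≼-dec : ∀ τ x y → Dec (x ≼[ τ ] y)
≼-dec τ x y = (x ℕ.≟ y) ⊎-dec map′ to from (anyUpTo? (λ z → (x <? z) ×-dec (τ z 𝔹.≟ τ x)) (suc y))
  where
  to : (∃ λ z → z < suc y × x < z × τ z ≡ τ x) → ∃ λ z → x < z × z ≤ y × τ z ≡ τ x
  to (z , s≤s z≤y , x<z , e) = z , x<z , z≤y , e
  from : (∃ λ z → x < z × z ≤ y × τ z ≡ τ x) → ∃ λ z → z < suc y × x < z × τ z ≡ τ x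
  from (z , x<z , z≤y , e) = z , s≤s z≤y , x<z , e

canonical : (ℕ → Bool) → Rel n
canonical τ i j = ⌊ ≼-dec τ (toℕ i) (toℕ j) ⌋

module _ {τ : ℕ → Bool} where

  ≼⇒≤ : ∀ {x y} → x ≼[ τ ] y → x ≤ y
  ≼⇒≤ (inj₁ refl) = ≤-refl
  ≼⇒≤ (inj₂ (z , x<z , z≤y , _)) = ≤-trans (<⇒≤ x<z) z≤y

  ≼-trans : ∀ {x y z} → x ≼[ τ ] y → y ≼[ τ ] z → x ≼[ τ ] z
  ≼-trans (inj₁ refl) y≼z = y≼z
  ≼-trans (inj₂ (w , x<w , w≤y , e)) y≼z = inj₂ (w , x<w , ≤-trans w≤y (≼⇒≤ y≼z) , e)

  same-colour⇒≼ : ∀ {x y} → x ≤ y → τ x ≡ τ y → x ≼[ τ ] y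
  same-colour⇒≼ {x} {y} x≤y e with x ℕ.≟ y
  ... | yes x≡y = inj₁ x≡y
  ... | no x≢y = inj₂ (y , ≤∧≢⇒< x≤y x≢y , ≤-refl , sym e)

canonical-isPoset : (τ : ℕ → Bool) → IsPoset {n} (canonical τ)
canonical-isPoset τ = mkIsPoset (canonical τ) (λ i → fromWitness (inj₁ refl))
  (λ i≼j j≼k → fromWitness (≼-trans (toWitness i≼j) (toWitness j≼k)))
  (λ i≼j j≼i → toℕ-injective (≤-antisym (≼⇒≤ (toWitness i≼j)) (≼⇒≤ (toWitness j≼i))))

canonical-cong : ∀ {n} {τ τ′ : ℕ → Bool} → (∀ k → k < n → τ k ≡ τ′ k) → ∀ (i j : Fin n) →
                 canonical τ i j ≡ canonical τ′ i j
canonical-cong {n = n} {τ = τ} {τ′} τ≗τ′ i j = begin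
  ⌊ ≼-dec τ (toℕ i) (toℕ j) ⌋      ≡⟨ isYes≗does (≼-dec τ (toℕ i) (toℕ j)) ⟩
  does (≼-dec τ (toℕ i) (toℕ j))   ≡⟨ does-⇔ (mk⇔ (transport τ≗τ′) (transport (λ k → sym ∘ τ≗τ′ k)))
                                            (≼-dec τ (toℕ i) (toℕ j)) (≼-dec τ′ (toℕ i) (toℕ j)) ⟩
  does (≼-dec τ′ (toℕ i) (toℕ j))  ≡⟨ isYes≗does (≼-dec τ′ (toℕ i) (toℕ j)) ⟨
  ⌊ ≼-dec τ′ (toℕ i) (toℕ j) ⌋     ∎
  where
  open ≡-Reasoning
  transport : ∀ {τ τ′} → (∀ k → k < n → τ k ≡ τ′ k) →
              toℕ i ≼[ τ ] toℕ j → toℕ i ≼[ τ′ ] toℕ j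
  transport _ (inj₁ i≡j) = inj₁ i≡j
  transport e (inj₂ (z , i<z , z≤j , τz≡τi)) =
    inj₂ (z , i<z , z≤j , trans (sym (e z (≤-<-trans z≤j (toℕ<n j)))) (trans τz≡τi (e (toℕ i) (toℕ<n i))))

-- For x < y these are exactly the canonically incomparable pairs; x is then the last position before
-- the run of τ y's colour that contains y.
Parent : (ℕ → Bool) → ℕ → ℕ → Set
Parent τ x y = x < y × (∀ z → x < z → z ≤ y → τ z ≢ τ x)

module _ {τ : ℕ → Bool} where

  Parent-colour : ∀ {x y} → Parent τ x y → τ y ≡ not (τ x)
  Parent-colour (x<y , differ) = 𝔹.¬-not (differ _ x<y ≤-refl)

  Parent⇒⋠ : ∀ {x y} → Parent τ x y → ¬ x ≼[ τ ] y
  Parent⇒⋠ (x<y , _) (inj₁ refl) = <-irrefl refl x<y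
  Parent⇒⋠ (_ , differ) (inj₂ (z , x<z , z≤y , e)) = differ z x<z z≤y e

  Parent⇒⋡ : ∀ {x y} → Parent τ x y → ¬ y ≼[ τ ] x
  Parent⇒⋡ (x<y , _) y≼x = <⇒≱ x<y (≼⇒≤ y≼x)

  ⋠⇒Parent : ∀ {x y} → x < y → ¬ x ≼[ τ ] y → Parent τ x y
  ⋠⇒Parent x<y x⋠y = x<y , λ z x<z z≤y e → x⋠y (inj₂ (z , x<z , z≤y , e))

  Parent-≮ : ∀ {x x′ y} → Parent τ x y → Parent τ x′ y → ¬ x < x′
  Parent-≮ P P′ x<x′ = proj₂ P′ _ (proj₁ P′) ≤-refl
    (trans (Parent-colour P) (sym (𝔹.¬-not (proj₂ P _ x<x′ (<⇒≤ (proj₁ P′))))))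

  Parent-unique : ∀ {x x′ y} → Parent τ x y → Parent τ x′ y → x ≡ x′
  Parent-unique {x} {x′} P P′ with <-cmp x x′
  ... | tri< x<x′ _ _ = contradiction x<x′ (Parent-≮ P P′)
  ... | tri≈ _ x≡x′ _ = x≡x′
  ... | tri> _ _ x′<x = contradiction x′<x (Parent-≮ P′ P)

  parent : τ 0 ≢ τ 1 → ∀ y → ∃ λ x → Parent τ x (suc y)
  parent τ0≢τ1 y with τ y 𝔹.≟ τ (suc y)
  ... | no τy≢τy+1 =
    y , ≤-refl , λ z y<z z≤y+1 → τy≢τy+1 ∘ sym ∘ subst (λ w → τ w ≡ τ y) (≤-antisym z≤y+1 y<z)
  parent τ0≢τ1 zero | yes τ0≡τ1 = contradiction τ0≡τ1 τ0≢τ1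
  parent τ0≢τ1 (suc y) | yes τy≡τy+1 with parent τ0≢τ1 y
  ... | x , x<y , differ = x , m≤n⇒m≤1+n x<y , differ′
    where
    differ′ : ∀ z → x < z → z ≤ suc (suc y) → τ z ≢ τ x
    differ′ z x<z z≤y+1 with m≤n⇒m<n∨m≡n z≤y+1
    ... | inj₁ z<y+1 = differ z x<z (≤-pred z<y+1)
    ... | inj₂ refl = differ (suc y) x<y ≤-refl ∘ trans τy≡τy+1

-- Canonical 2-chains

module CanonicalTwoChain {n} (τ : ℕ → Bool) (τ0≢τ1 : τ 0 ≢ τ 1) (2≤n : 2 ≤ n) where

  canon : Rel n
  canon = canonical τ

  colour : Fin n → Bool
  colour i = τ (toℕ i)

  0F 1F : Fin n
  0F = fromℕ< {0} (≤-trans (s≤s z≤n) 2≤n)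
  1F = fromℕ< {1} 2≤n

  Parent⇒incomparable : Parent τ (toℕ i) (toℕ j) → Incomparable canon i j
  Parent⇒incomparable P = Parent⇒⋠ P ∘ toWitness , Parent⇒⋡ P ∘ toWitness

  incomparable⇒Parent : toℕ i < toℕ j → Incomparable canon i j → Parent τ (toℕ i) (toℕ j)
  incomparable⇒Parent i<j (i⋠j , _) = ⋠⇒Parent i<j (i⋠j ∘ fromWitness)

  same-colour⇒comparable : colour i ≡ colour j → Comparable canon i j
  same-colour⇒comparable {i} {j} e with ≤-total (toℕ i) (toℕ j)
  ... | inj₁ i≤j = inj₁ (fromWitness (same-colour⇒≼ i≤j e))
  ... | inj₂ j≤i = inj₂ (fromWitness (same-colour⇒≼ j≤i (sym e)))

  incomparable⇒colour-flips : Incomparable canon i j → colour j ≡ not (colour i)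
  incomparable⇒colour-flips i∥j =
    𝔹.¬-not (incomparable⇒¬comparable {R = canon} i∥j ∘ same-colour⇒comparable ∘ sym)

  parentOf : ∀ y {k} → toℕ y ≡ suc k → ∃ λ x → Parent τ (toℕ x) (toℕ y)
  parentOf y {k} y≡k+1 with parent τ0≢τ1 k
  ... | x , P = fromℕ< (<-trans (proj₁ P) (subst (_< n) y≡k+1 (toℕ<n y))) ,
                subst₂ (Parent τ) (sym (toℕ-fromℕ< _)) (sym y≡k+1) P

  partner : ∀ y → ∃ (Incomparable canon y)
  partner y = by-position (toℕ y) refl
    where
    only-1 : ∀ z → 0 < z → z ≤ 1 → τ z ≢ τ 0
    only-1 z 0<z z≤1 rewrite ≤-antisym z≤1 0<z = τ0≢τ1 ∘ sym
    by-position : ∀ k → toℕ y ≡ k → ∃ (Incomparable canon y)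
    by-position zero y≡0 =
      1F , Parent⇒incomparable (subst₂ (Parent τ) (sym y≡0) (sym (toℕ-fromℕ< 2≤n)) (s≤s z≤n , only-1))
    by-position (suc k) y≡k+1 = Σ.map id (incomparable-sym {R = canon} ∘ Parent⇒incomparable) (parentOf y y≡k+1)

  module _ {A B : Subset n} (cover : IsTwoChainCover canon A B) where

    offset : Fin n → Bool
    offset y = lookup A y xor colour y

    offset-parent : Parent τ (toℕ u) (toℕ v) → offset v ≡ offset u
    offset-parent {u} {v} P = begin
      lookup A v xor colour v             ≡⟨ cong₂ _xor_ (cover-colour-flips cover (Parent⇒incomparable P))
                                                         (Parent-colour P) ⟩
      not (lookup A u) xor not (colour u) ≡⟨ not-xor-not (lookup A u) (colour u) ⟩
      lookup A u xor colour u             ∎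
      where open ≡-Reasoning

    offset-constant : ∀ y → Acc Fin._<_ y → offset y ≡ offset 0F
    offset-constant y (acc smaller) = by-position (toℕ y) refl
      where
      by-position : ∀ k → toℕ y ≡ k → offset y ≡ offset 0F
      by-position zero y≡0 = cong offset (toℕ-injective (trans y≡0 (sym (toℕ-fromℕ< _))))
      by-position (suc k) y≡k+1 with parentOf y y≡k+1
      ... | x , P = trans (offset-parent P) (offset-constant x (smaller (proj₁ P)))

    lookup-A : ∀ y → lookup A y ≡ offset 0F xor colour y
    lookup-A y = trans (sym (xor-cancelʳ (lookup A y) (colour y)))
                       (cong (_xor colour y) (offset-constant y (<-wellFounded y)))

    lookup-B : ∀ y → lookup B y ≡ not (offset 0F xor colour y)
    lookup-B y = trans (cover-complement cover (proj₂ (partner y))) (cong not (lookup-A y))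

    colour-cover-unique : SameWay A B (tabulate colour) (tabulate (not ∘ colour))
    colour-cover-unique = by-offset (offset 0F) lookup-A lookup-B
      where
      by-offset : ∀ c → (∀ y → lookup A y ≡ c xor colour y) → (∀ y → lookup B y ≡ not (c xor colour y)) →
                  SameWay A B (tabulate colour) (tabulate (not ∘ colour))
      by-offset false A≗ B≗ = inj₁ (≡-tabulate A≗ , ≡-tabulate B≗)
      by-offset true A≗ B≗ =
        inj₂ (≡-tabulate A≗ , ≡-tabulate (λ y → trans (B≗ y) (𝔹.not-involutive (colour y))))

  unique : UniqueTwoChainCover canon
  unique = (tabulate colour , tabulate (not ∘ colour) , colourCover colour (λ _ _ → same-colour⇒comparable)) ,
           λ A B A′ B′ cover cover′ →
             SameWay-trans (colour-cover-unique cover) (SameWay-sym (colour-cover-unique cover′))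

  module _ (R⁺ : Rel n) (canon⊆R⁺ : ∀ i j → Holds canon i j → Holds R⁺ i j) where

    recolouredCovers : (switch : Fin n → Bool) {a b : Fin n} → Comparable R⁺ a b →
                       switch a ≡ false → switch b ≡ true →
                       (∀ u v → toℕ u < toℕ v → Incomparable canon u v →
                                switch u ≢ switch v → u ≡ a × v ≡ b) →
                       SeveralTwoChainCovers R⁺
    recolouredCovers switch {a} {b} ab⁺ switch-a switch-b only-ab =
      tabulate colour , tabulate (not ∘ colour) , tabulate recolour , tabulate (not ∘ recolour) ,
      colourCover colour (λ i j → ⊎.map (canon⊆R⁺ i j) (canon⊆R⁺ j i) ∘ same-colour⇒comparable) ,
      colourCover recolour monochromatic , different
      where
      recolour : Fin n → Bool
      recolour z = switch z xor colour z

      switched : Incomparable canon i j → recolour i ≡ recolour j → switch i ≢ switch j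
      switched {i} {j} i∥j e =
        xor-flip⇒≢ (switch i) (colour i) (trans e (cong (switch j xor_) (incomparable⇒colour-flips i∥j)))

      monochromatic : ∀ i j → recolour i ≡ recolour j → Comparable R⁺ i j
      monochromatic i j e with T? (canon i j) | T? (canon j i)
      ... | yes i≼j | _ = inj₁ (canon⊆R⁺ i j i≼j)
      ... | no _ | yes j≼i = inj₂ (canon⊆R⁺ j i j≼i)
      ... | no i⋠j | no j⋠i with <-cmp (toℕ i) (toℕ j)
      ...   | tri< i<j _ _ with refl , refl ← only-ab i j i<j (i⋠j , j⋠i) (switched (i⋠j , j⋠i) e) = ab⁺
      ...   | tri≈ _ i≡j _ = contradiction (fromWitness (inj₁ i≡j)) i⋠j
      ...   | tri> _ _ j<i with refl , refl ← only-ab j i j<i (j⋠i , i⋠j) (switched (j⋠i , i⋠j) (sym e)) =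
                ⊎.swap ab⁺

      different : ¬ SameWay (tabulate colour) (tabulate (not ∘ colour)) (tabulate recolour) (tabulate (not ∘ recolour))
      different (inj₁ (e , _)) = 𝔹.not-¬ refl (begin
        colour b           ≡⟨ tabulate-≡⇒lookup colour e b ⟨
        lookup (tabulate recolour) b ≡⟨ lookup∘tabulate recolour b ⟩
        switch b xor colour b ≡⟨ cong (_xor colour b) switch-b ⟩
        not (colour b)     ∎)
        where open ≡-Reasoning
      different (inj₂ (e , _)) = 𝔹.not-¬ refl (begin
        colour a           ≡⟨ tabulate-≡⇒lookup colour e a ⟨
        lookup (tabulate (not ∘ recolour)) a ≡⟨ lookup∘tabulate (not ∘ recolour) a ⟩
        not (switch a xor colour a) ≡⟨ cong (λ s → not (s xor colour a)) switch-a ⟩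
        not (colour a)     ∎)
        where open ≡-Reasoning

    -- The switch must separate a from b and no other incomparable pair: if the colour of b continues at
    -- b + 1 then switching b alone does this, and otherwise switching every position from b on does.
    module _ {a b : Fin n} (a<b : toℕ a < toℕ b) (a∥b : Incomparable canon a b) (ab⁺ : Comparable R⁺ a b) where

      private
        parent-of-b : ∀ {u} → toℕ u < toℕ b → Incomparable canon u b → u ≡ a
        parent-of-b u<b u∥b =
          toℕ-injective (Parent-unique (incomparable⇒Parent u<b u∥b) (incomparable⇒Parent a<b a∥b))

        switch-at-b : τ (suc (toℕ b)) ≡ τ (toℕ b) → SeveralTwoChainCovers R⁺
        switch-at-b τb+1≡τb =
          recolouredCovers (λ z → does (z ≟ b)) ab⁺ (dec-false (a ≟ b) (<⇒≢ a<b)) (dec-true (b ≟ b) refl) only-ab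
          where
          only-ab : ∀ u v → toℕ u < toℕ v → Incomparable canon u v →
                    does (u ≟ b) ≢ does (v ≟ b) → u ≡ a × v ≡ b
          only-ab u v u<v u∥v switched with u ≟ b | v ≟ b
          ... | yes refl | yes refl = contradiction u<v (<-irrefl refl)
          ... | no _ | no _ = contradiction refl switched
          ... | no _ | yes refl = parent-of-b u<v u∥v , refl
          ... | yes refl | no _ = contradiction τb+1≡τb (proj₂ (incomparable⇒Parent u<v u∥v) _ ≤-refl u<v)

        switch-from-b : τ (suc (toℕ b)) ≢ τ (toℕ b) → SeveralTwoChainCovers R⁺
        switch-from-b τb+1≢τb =
          recolouredCovers (λ z → does (toℕ b ≤? toℕ z)) ab⁺
                           (dec-false (toℕ b ≤? toℕ a) (<⇒≱ a<b)) (dec-true (toℕ b ≤? toℕ b) ≤-refl) only-ab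
          where
          only-ab : ∀ u v → toℕ u < toℕ v → Incomparable canon u v →
                    does (toℕ b ≤? toℕ u) ≢ does (toℕ b ≤? toℕ v) → u ≡ a × v ≡ b
          only-ab u v u<v u∥v switched with toℕ b ≤? toℕ u | toℕ b ≤? toℕ v
          ... | yes b≤u | _ = contradiction (trans (dec-true (toℕ b ≤? toℕ u) b≤u)
                                                   (sym (dec-true (toℕ b ≤? toℕ v) (≤-trans b≤u (<⇒≤ u<v)))))
                                            switched
          ... | no b≰u | no b≰v = contradiction (trans (dec-false (toℕ b ≤? toℕ u) b≰u)
                                                       (sym (dec-false (toℕ b ≤? toℕ v) b≰v)))
                                                switched
          ... | no b≰u | yes b≤v with m≤n⇒m<n∨m≡n b≤v
          ...   | inj₂ b≡v with refl ← toℕ-injective b≡v = parent-of-b u<v u∥v , refl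
          ...   | inj₁ b<v = contradiction (trans (𝔹.¬-not (differ _ (<-trans u<b (n<1+n _)) b<v))
                                                  (sym (𝔹.¬-not (differ _ u<b (<⇒≤ b<v)))))
                                           τb+1≢τb
            where
            u<b = ≰⇒> b≰u
            differ = proj₂ (incomparable⇒Parent u<v u∥v)

      separate : SeveralTwoChainCovers R⁺
      separate with τ (suc (toℕ b)) 𝔹.≟ τ (toℕ b)
      ... | yes τb+1≡τb = switch-at-b τb+1≡τb
      ... | no τb+1≢τb = switch-from-b τb+1≢τb

  maximal : ∀ R⁺ → IsProperRefinement canon R⁺ → SeveralTwoChainCovers R⁺
  maximal R⁺ (poset⁺ , canon⊆R⁺ , i , j , i≤⁺j , i⋠j) = by-position (<-cmp (toℕ i) (toℕ j))
    where
    j⋠i : ¬ Holds canon j i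
    j⋠i j≼i = i⋠j (subst (Holds canon i) (IsPartialOrder.antisym poset⁺ i≤⁺j (canon⊆R⁺ j i j≼i))
                        (fromWitness (inj₁ refl)))
    by-position : Tri (toℕ i < toℕ j) (toℕ i ≡ toℕ j) (toℕ j < toℕ i) → SeveralTwoChainCovers R⁺
    by-position (tri< i<j _ _) = separate R⁺ canon⊆R⁺ i<j (i⋠j , j⋠i) (inj₁ i≤⁺j)
    by-position (tri≈ _ i≡j _) = contradiction (fromWitness (inj₁ i≡j)) i⋠j
    by-position (tri> _ _ j<i) = separate R⁺ canon⊆R⁺ j<i (j⋠i , i⋠j) (inj₂ i≤⁺j)

  isTwoChain : IsTwoChain canon
  isTwoChain = canonical-isPoset τ , unique , maximal

  downDegree-position : ∀ z → downDegree canon z ≡ toℕ z ∸ 1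
  downDegree-position z = by-position (toℕ z) refl
    where
    by-position : ∀ k → toℕ z ≡ k → downDegree canon z ≡ k ∸ 1
    by-position zero z≡0 = count-∅ (λ w → strict? canon w z) λ w (w≼z , w≢z) →
      w≢z (toℕ-injective (trans (n≤0⇒n≡0 (subst (toℕ w ≤_) z≡0 (≼⇒≤ (toWitness w≼z)))) (sym z≡0)))
    by-position (suc k) z≡k+1 with parentOf z z≡k+1
    ... | p , P = ℕₚ.suc-injective (begin
      suc (downDegree canon z)               ≡⟨ cong suc (count-cong (λ w → strict? canon w z) earlier? below⇔) ⟩
      suc (count earlier?)                   ≡⟨ count-remove (λ (w : Fin n) → toℕ w <? toℕ z) (proj₁ P) ⟨
      count (λ (w : Fin n) → toℕ w <? toℕ z) ≡⟨ count-toℕ< (toℕ z) (<⇒≤ (toℕ<n z)) ⟩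
      toℕ z                                  ≡⟨ z≡k+1 ⟩
      suc k                                  ∎)
      where
      open ≡-Reasoning
      earlier? = λ w → (toℕ w <? toℕ z) ×-dec ¬? (p ≟ w)
      below⇔ : ∀ w → Strict canon w z ⇔ (toℕ w < toℕ z × p ≢ w)
      below⇔ w = mk⇔ (λ (w≼z , w≢z) → ≤∧≢⇒< (≼⇒≤ (toWitness w≼z)) (w≢z ∘ toℕ-injective) ,
                                        λ { refl → Parent⇒⋠ P (toWitness w≼z) })
                     (λ (w<z , p≢w) → fromWitness (decidable-stable (≼-dec τ (toℕ w) (toℕ z)) λ w⋠z →
                                                     p≢w (toℕ-injective (Parent-unique P (⋠⇒Parent w<z w⋠z)))) ,
                                      λ { refl → <-irrefl refl w<z })

  successor : toℕ j ≡ suc (toℕ i) → canon i j ≡ does (colour j 𝔹.≟ colour i)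
  successor {j} {i} j≡i+1 =
    trans (isYes≗does (≼-dec τ (toℕ i) (toℕ j)))
          (does-⇔ (mk⇔ to from) (≼-dec τ (toℕ i) (toℕ j)) (colour j 𝔹.≟ colour i))
    where
    to : toℕ i ≼[ τ ] toℕ j → colour j ≡ colour i
    to (inj₁ i≡j) = contradiction (trans i≡j j≡i+1) (ℕₚ.<⇒≢ (n<1+n (toℕ i)))
    to (inj₂ (z , i<z , z≤j , e)) = trans (cong τ (≤-antisym (subst (_≤ z) (sym j≡i+1) i<z) z≤j)) e
    from : colour j ≡ colour i → toℕ i ≼[ τ ] toℕ j
    from e = same-colour⇒≼ (subst (toℕ i ≤_) (sym j≡i+1) (n≤1+n (toℕ i))) (sym e)

∸1-injective : ∀ {x y} → 2 ≤ x → x ∸ 1 ≡ y ∸ 1 → x ≡ y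
∸1-injective {y = suc y} (s≤s (s≤s _)) e = cong suc e
∸1-injective {y = zero} (s≤s (s≤s _)) ()

module CanonicalIsomorphism {n} (τ τ′ : ℕ → Bool) (τ0≢τ1 : τ 0 ≢ τ 1) (τ′0≢τ′1 : τ′ 0 ≢ τ′ 1)
                            (2≤n : 2 ≤ n) (iso : Isomorphic (canonical {n} τ) (canonical τ′)) where

  private
    module C = CanonicalTwoChain τ τ0≢τ1 2≤n
    module C′ = CanonicalTwoChain τ′ τ′0≢τ′1 2≤n
    σ = proj₁ iso

  fixes : ∀ z → 2 ≤ toℕ z → σ ⟨$⟩ʳ z ≡ z
  fixes z 2≤z = toℕ-injective (sym (∸1-injective 2≤z (begin
    toℕ z ∸ 1                      ≡⟨ C.downDegree-position z ⟨
    downDegree C.canon z           ≡⟨ downDegree-invariant C.canon C′.canon iso z ⟩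
    downDegree C′.canon (σ ⟨$⟩ʳ z) ≡⟨ C′.downDegree-position (σ ⟨$⟩ʳ z) ⟩
    toℕ (σ ⟨$⟩ʳ z) ∸ 1             ∎)))
    where open ≡-Reasoning

  successor-agrees : ∀ {p q} → toℕ q ≡ suc (toℕ p) → 2 ≤ toℕ p →
                     C.colour p ≡ C′.colour p → C.colour q ≡ C′.colour q
  successor-agrees {p} {q} q≡p+1 2≤p same-p = does-≟-injective (begin
    does (C.colour q 𝔹.≟ C.colour p)    ≡⟨ C.successor q≡p+1 ⟨
    C.canon p q                         ≡⟨ proj₂ iso p q ⟩
    C′.canon (σ ⟨$⟩ʳ p) (σ ⟨$⟩ʳ q)      ≡⟨ cong₂ C′.canon (fixes p 2≤p) (fixes q 2≤q) ⟩
    C′.canon p q                        ≡⟨ C′.successor q≡p+1 ⟩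
    does (C′.colour q 𝔹.≟ C′.colour p)  ≡⟨ cong (does ∘ (C′.colour q 𝔹.≟_)) same-p ⟨
    does (C′.colour q 𝔹.≟ C.colour p)   ∎)
    where
    open ≡-Reasoning
    2≤q = subst (2 ≤_) (sym q≡p+1) (m≤n⇒m≤1+n 2≤p)

  colours-agree : τ 2 ≡ τ′ 2 → ∀ k → 2 + k < n → τ (2 + k) ≡ τ′ (2 + k)
  colours-agree τ2≡τ′2 zero _ = τ2≡τ′2
  colours-agree τ2≡τ′2 (suc k) 3+k<n =
    subst (λ x → τ x ≡ τ′ x) q≡
      (successor-agrees (trans q≡ (cong suc (sym p≡))) (subst (2 ≤_) (sym p≡) (m≤m+n 2 k))
                        (subst (λ x → τ x ≡ τ′ x) (sym p≡) (colours-agree τ2≡τ′2 k 2+k<n)))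
    where
    2+k<n = <-trans (n<1+n (2 + k)) 3+k<n
    p≡ = toℕ-fromℕ< 2+k<n
    q≡ = toℕ-fromℕ< 3+k<n

-- The family

_!_ : ∀ {m} → Vec Bool m → ℕ → Bool
[] ! k = false
(b ∷ v) ! zero = b
(b ∷ v) ! suc k = v ! k

!-ext : ∀ {m} (v w : Vec Bool m) → (∀ k → k < m → v ! k ≡ w ! k) → v ≡ w
!-ext [] [] _ = refl
!-ext (a ∷ v) (b ∷ w) v≗w = cong₂ _∷_ (v≗w 0 (s≤s z≤n)) (!-ext v w (λ k k<m → v≗w (suc k) (s≤s k<m)))

prefix : (ℕ → Bool) → ∀ m → Vec Bool m
prefix f zero = []
prefix f (suc m) = f 0 ∷ prefix (f ∘ suc) m

!-prefix : ∀ f {m k} → k < m → prefix f m ! k ≡ f k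
!-prefix f {suc m} {zero} _ = refl
!-prefix f {suc m} {suc k} (s≤s k<m) = !-prefix (f ∘ suc) k<m

word : ∀ {m} → Vec Bool m → ℕ → Bool
word v 0 = true
word v 1 = false
word v 2 = true
word v (suc (suc (suc k))) = v ! k

family : ∀ n → Vec Bool (n ∸ 3) → Rel n
family n v = canonical (word v)

family-isTwoChain : ∀ n → 3 ≤ n → (v : Vec Bool (n ∸ 3)) → IsTwoChain (family n v)
family-isTwoChain n 3≤n v = CanonicalTwoChain.isTwoChain (word v) (λ ()) (≤-trans (n≤1+n 2) 3≤n)

family-injective : ∀ n → 3 ≤ n → (v w : Vec Bool (n ∸ 3)) → Isomorphic (family n v) (family n w) → v ≡ w
family-injective n 3≤n v w iso = !-ext v w λ k k<n∸3 →
  CanonicalIsomorphism.colours-agree (word v) (word w) (λ ()) (λ ()) (≤-trans (n≤1+n 2) 3≤n) iso refl (suc k)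
    (subst (3 + k <_) (m+[n∸m]≡n 3≤n) (+-monoʳ-< 3 k<n∸3))

vectors : ∀ m → List (Vec Bool m)
vectors zero = [] ∷ []
vectors (suc m) = map (true ∷_) (vectors m) ++ map (false ∷_) (vectors m)

length-vectors : ∀ m → length (vectors m) ≡ 2 ^ m
length-vectors zero = refl
length-vectors (suc m) = begin
  length (map (true ∷_) vs ++ map (false ∷_) vs)         ≡⟨ length-++ (map (true ∷_) vs) ⟩
  length (map (true ∷_) vs) + length (map (false ∷_) vs) ≡⟨ cong₂ _+_ (length-map _ vs) (length-map _ vs) ⟩
  length vs + length vs                                  ≡⟨ cong (λ k → k + k) (length-vectors m) ⟩
  2 ^ m + 2 ^ m                                          ≡⟨ cong (2 ^ m +_) (+-identityʳ (2 ^ m)) ⟨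
  2 ^ suc m                                              ∎
  where
  open ≡-Reasoning
  vs = vectors m

∈-vectors : ∀ {m} (v : Vec Bool m) → v ∈ₗ vectors m
∈-vectors [] = here refl
∈-vectors {suc m} (true ∷ v) = ∈-++⁺ˡ (∈-map⁺ (true ∷_) (∈-vectors v))
∈-vectors {suc m} (false ∷ v) = ∈-++⁺ʳ (map (true ∷_) (vectors m)) (∈-map⁺ (false ∷_) (∈-vectors v))

vectors-distinct : ∀ m → AllPairs _≢_ (vectors m)
vectors-distinct zero = [] ∷ []
vectors-distinct (suc m) =
  AllPairs.++⁺ (AllPairs.map⁺ (AllPairs.map (_∘ ∷-injectiveʳ) (vectors-distinct m)))
               (AllPairs.map⁺ (AllPairs.map (_∘ ∷-injectiveʳ) (vectors-distinct m)))
               (All.map⁺ (All.universal (λ _ → All.map⁺ (All.universal (λ _ ()) (vectors m))) (vectors m)))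

-- Structure of 2-chains

-- In the labelling below, the chosen minimal element goes to 0, the other minimal element to 1, and every
-- other element to one more than its down-degree.
place : ℕ → Bool → ℕ
place zero true = 0
place zero false = 1
place (suc d) _ = suc (suc d)

place-∸1 : ∀ d b → place d b ∸ 1 ≡ d
place-∸1 zero true = refl
place-∸1 zero false = refl
place-∸1 (suc d) b = refl

place-mono : ∀ {d d′} b b′ → d < d′ → place d b < place d′ b′
place-mono {d} {suc d′} b b′ (s≤s d≤d′) = s≤s (≤-trans (place≤1+ d b) (s≤s d≤d′))
  where
  place≤1+ : ∀ d b → place d b ≤ suc d
  place≤1+ zero true = z≤n
  place≤1+ zero false = ≤-refl
  place≤1+ (suc d) b = ≤-refl

place-bound : ∀ {n} d b → 2 + d ≤ n → place d b < n
place-bound zero true 2≤n = ≤-trans (s≤s z≤n) 2≤n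
place-bound zero false 2≤n = 2≤n
place-bound (suc d) b 3+d≤n = 3+d≤n

place-injective : ∀ d d′ b b′ → place d b ≡ place d′ b′ → (d ≡ 0 × d′ ≡ 0 × b ≡ b′) ⊎ (d ≡ d′ × 0 < d)
place-injective zero zero true true _ = inj₁ (refl , refl , refl)
place-injective zero zero false false _ = inj₁ (refl , refl , refl)
place-injective (suc d) (suc d′) _ _ e = inj₂ (ℕₚ.suc-injective e , s≤s z≤n)
place-injective zero zero true false ()
place-injective zero zero false true ()
place-injective zero (suc _) true _ ()
place-injective zero (suc _) false _ ()
place-injective (suc _) zero _ true ()
place-injective (suc _) zero _ false ()

module TwoChainStructure {n} (R : Rel n) (twoChain : IsTwoChain R) where

  private
    poset = proj₁ twoChain
    unique = proj₁ (proj₂ twoChain)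
    maximal = proj₂ (proj₂ twoChain)
    A = proj₁ (proj₁ unique)
    B = proj₁ (proj₂ (proj₁ unique))
    cover : IsTwoChainCover R A B
    cover = proj₂ (proj₂ (proj₁ unique))

  infix 4 _≤ᴿ_ _<ᴿ_ _∥_
  _≤ᴿ_ _<ᴿ_ _∥_ : Fin n → Fin n → Set
  _≤ᴿ_ = Holds R
  _<ᴿ_ = Strict R
  _∥_ = Incomparable R

  ≤ᴿ-refl : ∀ i → i ≤ᴿ i
  ≤ᴿ-refl i = IsPartialOrder.refl poset

  ≤ᴿ-trans : ∀ {i j k} → i ≤ᴿ j → j ≤ᴿ k → i ≤ᴿ k
  ≤ᴿ-trans = IsPartialOrder.trans poset

  ≤ᴿ-antisym : ∀ {i j} → i ≤ᴿ j → j ≤ᴿ i → i ≡ j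
  ≤ᴿ-antisym = IsPartialOrder.antisym poset

  <ᴿ-≤ᴿ-trans : ∀ {i j k} → i <ᴿ j → j ≤ᴿ k → i <ᴿ k
  <ᴿ-≤ᴿ-trans (i≤j , i≢j) j≤k = ≤ᴿ-trans i≤j j≤k , λ { refl → i≢j (≤ᴿ-antisym i≤j j≤k) }

  ≤ᴿ-<ᴿ-trans : ∀ {i j k} → i ≤ᴿ j → j <ᴿ k → i <ᴿ k
  ≤ᴿ-<ᴿ-trans i≤j (j≤k , j≢k) = ≤ᴿ-trans i≤j j≤k , λ { refl → j≢k (≤ᴿ-antisym j≤k i≤j) }

  ≤ᴿ⇒≡⊎<ᴿ : ∀ {i j} → i ≤ᴿ j → i ≡ j ⊎ i <ᴿ j
  ≤ᴿ⇒≡⊎<ᴿ {i} {j} i≤j with i ≟ j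
  ... | yes i≡j = inj₁ i≡j
  ... | no i≢j = inj₂ (i≤j , i≢j)

  ≤ᴿ-≮ᴿ⇒≡ : ∀ {i j} → i ≤ᴿ j → ¬ i <ᴿ j → i ≡ j
  ≤ᴿ-≮ᴿ⇒≡ i≤j i≮j = [ id , (λ i<j → contradiction i<j i≮j) ]′ (≤ᴿ⇒≡⊎<ᴿ i≤j)

  ∥⇒≢ : ∀ {i j} → i ∥ j → i ≢ j
  ∥⇒≢ {i} (i⋠j , _) refl = i⋠j (≤ᴿ-refl i)

  comparable? : ∀ i j → Comparable R i j ⊎ i ∥ j
  comparable? i j with T? (R i j) | T? (R j i)
  ... | yes i≤j | _ = inj₁ (inj₁ i≤j)
  ... | no _ | yes j≤i = inj₁ (inj₂ j≤i)
  ... | no i⋠j | no j⋠i = inj₂ (i⋠j , j⋠i)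

  ≤ᴿ-stable : ∀ {i j} → ¬ ¬ i ≤ᴿ j → i ≤ᴿ j
  ≤ᴿ-stable {i} {j} = decidable-stable (T? (R i j))

  colour : Fin n → Bool
  colour = lookup A

  same-colour⇒comparable : ∀ {u v} → colour u ≡ colour v → Comparable R u v
  same-colour⇒comparable {u} {v} e with colour u in cu
  ... | true = proj₁ cover u v (lookup⇒[]= u A cu) (lookup⇒[]= v A (sym e))
  ... | false = proj₁ (proj₂ cover) u v (∈B u cu) (∈B v (sym e))
    where
    ∈B : ∀ w → colour w ≡ false → w ∈ B
    ∈B w cw = [ (λ w∈A → contradiction (trans (sym ([]=⇒lookup w∈A)) cw) λ ()) , id ]′ (proj₂ (proj₂ cover) w)

  incomparable⇒colour-flips : ∀ {u v} → u ∥ v → colour v ≡ not (colour u)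
  incomparable⇒colour-flips = cover-colour-flips cover

  incomparable? : ∀ i j → Dec (i ∥ j)
  incomparable? i j = ¬? (T? (R i j)) ×-dec ¬? (T? (R j i))

  partner : ∀ z → ∃ (z ∥_)
  partner z with any? (incomparable? z)
  ... | yes z∥w = z∥w
  ... | no ∄z∥w = contradiction (comparable-to-all⇒several {R = R} comparable cover) (unique⇒¬several unique)
    where
    comparable : ∀ w → Comparable R z w
    comparable w = [ id , (λ z∥w → contradiction (w , z∥w) ∄z∥w) ]′ (comparable? z w)

  deg : Fin n → ℕ
  deg = downDegree R

  deg-mono : ∀ {u v} → u <ᴿ v → deg u < deg v
  deg-mono {u} {v} u<v = count-strict (λ w → strict? R w u) (λ w → strict? R w v)
                                      (λ w<u → <ᴿ-≤ᴿ-trans w<u (proj₁ u<v)) u<v (λ (_ , u≢u) → u≢u refl)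

  deg-bound : ∀ z → 2 + deg z ≤ n
  deg-bound z with partner z
  ... | w , z∥w = ≤-trans (count-two-gaps (λ w → strict? R w z) (U? {A = Fin n}) (λ _ → tt) (∥⇒≢ z∥w)
                                          tt (λ (_ , z≢z) → z≢z refl) tt (proj₂ z∥w ∘ proj₁))
                          (count≤n (U? {A = Fin n}))

  deg>0⇒below : ∀ {z} → 0 < deg z → ∃ (_<ᴿ z)
  deg>0⇒below {z} 0<deg = Σ.map id proj₁ (count-gap (∅? {A = Fin n}) (λ w → strict? R w z)
                                            (subst (_< deg z) (sym (count-∅ (∅? {A = Fin n}) λ _ ())) 0<deg))

  Minimal : Fin n → Set
  Minimal z = deg z ≡ 0

  minimal-below : ∀ z → Acc _<_ (deg z) → ∃ Minimal
  minimal-below z (acc smaller) with deg z ℕ.≟ 0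
  ... | yes z-minimal = z , z-minimal
  ... | no z-not-minimal with deg>0⇒below (n≢0⇒n>0 z-not-minimal)
  ...   | w , w<z = minimal-below w (smaller (deg-mono w<z))

  module AddPair {u v : Fin n} (u∥v : u ∥ v)
                 (below-u : ∀ {w} → w <ᴿ u → w ≤ᴿ v) (above-v : ∀ {w} → v <ᴿ w → u ≤ᴿ w) where

    R⁺ : Rel n
    R⁺ i j = R i j ∨ (⌊ i ≟ u ⌋ ∧ ⌊ j ≟ v ⌋)

    _≤⁺_ : Fin n → Fin n → Set
    _≤⁺_ = Holds R⁺

    ≤ᴿ⇒≤⁺ : ∀ {i j} → i ≤ᴿ j → i ≤⁺ j
    ≤ᴿ⇒≤⁺ {i} {j} i≤j = Equivalence.from (𝔹.T-∨ {R i j}) (inj₁ i≤j)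

    u≤⁺v : u ≤⁺ v
    u≤⁺v = Equivalence.from (𝔹.T-∨ {R u v})
            (inj₂ (Equivalence.from (𝔹.T-∧ {⌊ u ≟ u ⌋}) (fromWitness refl , fromWitness refl)))

    ≤⁺-cases : ∀ {i j} → i ≤⁺ j → i ≤ᴿ j ⊎ (i ≡ u × j ≡ v)
    ≤⁺-cases {i} {j} i≤⁺j =
      ⊎.map id (Σ.map (toWitness {a? = i ≟ u}) (toWitness {a? = j ≟ v}) ∘ Equivalence.to (𝔹.T-∧ {⌊ i ≟ u ⌋}))
            (Equivalence.to (𝔹.T-∨ {R i j}) i≤⁺j)

    u≢v : u ≢ v
    u≢v = ∥⇒≢ u∥v

    ≤⁺-trans : ∀ {i j k} → i ≤⁺ j → j ≤⁺ k → i ≤⁺ k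
    ≤⁺-trans {i} {j} {k} i≤j j≤k with ≤⁺-cases i≤j | ≤⁺-cases j≤k
    ... | inj₁ i≤j | inj₁ j≤k = ≤ᴿ⇒≤⁺ (≤ᴿ-trans i≤j j≤k)
    ... | inj₁ i≤u | inj₂ (refl , refl) with ≤ᴿ⇒≡⊎<ᴿ i≤u
    ...   | inj₁ refl = u≤⁺v
    ...   | inj₂ i<u = ≤ᴿ⇒≤⁺ (below-u i<u)
    ≤⁺-trans {i} {j} {k} _ _ | inj₂ (refl , refl) | inj₁ v≤k with ≤ᴿ⇒≡⊎<ᴿ v≤k
    ...   | inj₁ refl = u≤⁺v
    ...   | inj₂ v<k = ≤ᴿ⇒≤⁺ (above-v v<k)
    ≤⁺-trans _ _ | inj₂ (_ , refl) | inj₂ (v≡u , _) = contradiction (sym v≡u) u≢v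

    ≤⁺-antisym : ∀ {i j} → i ≤⁺ j → j ≤⁺ i → i ≡ j
    ≤⁺-antisym i≤j j≤i with ≤⁺-cases i≤j | ≤⁺-cases j≤i
    ... | inj₁ i≤j | inj₁ j≤i = ≤ᴿ-antisym i≤j j≤i
    ... | inj₁ v≤u | inj₂ (refl , refl) = contradiction v≤u (proj₂ u∥v)
    ... | inj₂ (refl , refl) | inj₁ v≤u = contradiction v≤u (proj₂ u∥v)
    ... | inj₂ (refl , refl) | inj₂ (v≡u , _) = contradiction (sym v≡u) u≢v

    refinement : IsProperRefinement R R⁺
    refinement = mkIsPoset R⁺ (≤ᴿ⇒≤⁺ ∘ ≤ᴿ-refl) ≤⁺-trans ≤⁺-antisym , (λ _ _ → ≤ᴿ⇒≤⁺) , u , v , u≤⁺v , proj₁ u∥v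

    ∥⇒∥⁺ : ∀ {a b} → a ∥ b → ¬ (a ≡ u × b ≡ v) → ¬ (b ≡ u × a ≡ v) → Incomparable R⁺ a b
    ∥⇒∥⁺ (a⋠b , b⋠a) not-uv not-vu = [ a⋠b , not-uv ]′ ∘ ≤⁺-cases , [ b⋠a , not-vu ]′ ∘ ≤⁺-cases

    chain⁺⇒chain : {C : Subset n} → IsChain R⁺ C → ¬ (u ∈ C × v ∈ C) → IsChain R C
    chain⁺⇒chain chain⁺ not-both i j i∈C j∈C with chain⁺ i j i∈C j∈C
    ... | inj₁ i≤⁺j = inj₁ ([ id , (λ { (refl , refl) → contradiction (i∈C , j∈C) not-both }) ]′ (≤⁺-cases i≤⁺j))
    ... | inj₂ j≤⁺i = inj₂ ([ id , (λ { (refl , refl) → contradiction (j∈C , i∈C) not-both }) ]′ (≤⁺-cases j≤⁺i))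

    module _ {x y : Fin n} (v∥x : v ∥ x) (x∥y : x ∥ y) (y∥u : y ∥ u) (x≢u : x ≢ u) (y≢v : y ≢ v) where

      private
        u∥⁺y = incomparable-sym {R = R⁺} (∥⇒∥⁺ y∥u (∥⇒≢ y∥u ∘ proj₁) (y≢v ∘ proj₂))
        v∥⁺x = ∥⇒∥⁺ v∥x (u≢v ∘ sym ∘ proj₁) (x≢u ∘ proj₁)
        x∥⁺y = ∥⇒∥⁺ x∥y (x≢u ∘ proj₁) (∥⇒≢ y∥u ∘ proj₁)

        separated : {C D : Subset n} → IsTwoChainCover R⁺ C D → ¬ (u ∈ C × v ∈ C)
        separated {C} {D} (chainC , chainD , covers) (u∈C , v∈C) =
          chain-incomparable {R = R⁺} chainD x∥⁺y (in-D x (chain-incomparable {R = R⁺} chainC v∥⁺x v∈C))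
                                                  (in-D y (chain-incomparable {R = R⁺} chainC u∥⁺y u∈C))
          where
          in-D : ∀ w → w ∉ C → w ∈ D
          in-D w w∉C = [ (λ w∈C → contradiction w∈C w∉C) , id ]′ (covers w)

        same-as-R : {C D : Subset n} → IsTwoChainCover R⁺ C D → SameWay C D A B
        same-as-R cover⁺@(chainC , chainD , covers) =
          proj₂ unique _ _ A B (chain⁺⇒chain chainC (separated cover⁺) ,
                                chain⁺⇒chain chainD (separated (swap-cover {R = R⁺} cover⁺)) , covers) cover

      -- A cover of R⁺ keeping u and v apart is a cover of R, so maximality yields a cover of R⁺ with u and v
      -- in one chain; the incomparable x and y would then both lie in the other chain.
      no-incomparable-path : ⊥
      no-incomparable-path with maximal R⁺ refinement
      ... | C , D , C′ , D′ , cover⁺ , cover⁺′ , different =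
            different (SameWay-trans (same-as-R cover⁺) (SameWay-sym (same-as-R cover⁺′)))

  TwoPlusTwo : Fin n → Fin n → Fin n → Fin n → Set
  TwoPlusTwo x y x′ y′ = x <ᴿ y × x′ <ᴿ y′ × x ∥ x′ × x ∥ y′ × y ∥ x′ × y ∥ y′

  -- Raise y or lower x′ while the configuration survives; when neither is possible, adding x′ ≤ y is a
  -- refinement in which y ∥ y′ ∥ x ∥ x′ is an incomparable path.
  no-2+2-from : ∀ {x y x′ y′} → Acc _<_ ((n ∸ deg y) + deg x′) → ¬ TwoPlusTwo x y x′ y′
  no-2+2-from {x} {y} {x′} {y′} (acc smaller) (x<y , x′<y′ , x∥x′ , x∥y′ , y∥x′ , y∥y′)
    with any? (λ w → strict? R y w ×-dec incomparable? w x′) | any? (λ w → strict? R w x′ ×-dec incomparable? w y)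
  ... | yes (w , y<w , w∥x′) | _ =
        no-2+2-from (smaller raise-y) (<ᴿ-≤ᴿ-trans x<y (proj₁ y<w) , x′<y′ , x∥x′ , x∥y′ , w∥x′ , w∥y′)
    where
    w∥y′ : w ∥ y′
    w∥y′ = (λ w≤y′ → proj₁ y∥y′ (≤ᴿ-trans (proj₁ y<w) w≤y′)) , (λ y′≤w → proj₂ w∥x′ (≤ᴿ-trans (proj₁ x′<y′) y′≤w))
    raise-y : (n ∸ deg w) + deg x′ < (n ∸ deg y) + deg x′
    raise-y = +-monoˡ-< (deg x′) (∸-monoʳ-< (deg-mono y<w) (≤-trans (m≤n+m (deg w) 2) (deg-bound w)))
  ... | no _ | yes (w , w<x′ , w∥y) =
        no-2+2-from (smaller lower-x′)
                    (x<y , ≤ᴿ-<ᴿ-trans (proj₁ w<x′) x′<y′ , x∥w , x∥y′ , incomparable-sym {R = R} w∥y , y∥y′)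
    where
    x∥w : x ∥ w
    x∥w = (λ x≤w → proj₁ x∥x′ (≤ᴿ-trans x≤w (proj₁ w<x′))) , (λ w≤x → proj₁ w∥y (≤ᴿ-trans w≤x (proj₁ x<y)))
    lower-x′ : (n ∸ deg y) + deg w < (n ∸ deg y) + deg x′
    lower-x′ = +-monoʳ-< (n ∸ deg y) (deg-mono w<x′)
  ... | no ∄above | no ∄below =
        AddPair.no-incomparable-path (incomparable-sym {R = R} y∥x′) below-x′ above-y
          y∥y′ (incomparable-sym {R = R} x∥y′) x∥x′ (proj₂ x′<y′ ∘ sym) (proj₂ x<y)
    where
    below-x′ : ∀ {w} → w <ᴿ x′ → w ≤ᴿ y
    below-x′ {w} w<x′ with comparable? w y
    ... | inj₁ (inj₁ w≤y) = w≤y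
    ... | inj₁ (inj₂ y≤w) = contradiction (≤ᴿ-trans y≤w (proj₁ w<x′)) (proj₁ y∥x′)
    ... | inj₂ w∥y = contradiction (w , w<x′ , w∥y) ∄below
    above-y : ∀ {w} → y <ᴿ w → x′ ≤ᴿ w
    above-y {w} y<w with comparable? w x′
    ... | inj₁ (inj₁ w≤x′) = contradiction (≤ᴿ-trans (proj₁ y<w) w≤x′) (proj₁ y∥x′)
    ... | inj₁ (inj₂ x′≤w) = x′≤w
    ... | inj₂ w∥x′ = contradiction (w , y<w , w∥x′) ∄above

  no-2+2 : ∀ {x y x′ y′} → ¬ TwoPlusTwo x y x′ y′
  no-2+2 {y = y} {x′} = no-2+2-from (ℕ.<-wellFounded ((n ∸ deg y) + deg x′))

  nested : ∀ {u v} → u ∥ v → (∀ {w} → w <ᴿ u → w ≤ᴿ v) ⊎ (∀ {w} → w <ᴿ v → w ≤ᴿ u)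
  nested {u} {v} u∥v
    with any? (λ w → strict? R w u ×-dec ¬? (T? (R w v))) | any? (λ w → strict? R w v ×-dec ¬? (T? (R w u)))
  ... | no ∄w | _ = inj₁ λ {w} w<u → ≤ᴿ-stable λ w⋠v → ∄w (w , w<u , w⋠v)
  ... | yes _ | no ∄w = inj₂ λ {w} w<v → ≤ᴿ-stable λ w⋠u → ∄w (w , w<v , w⋠u)
  ... | yes (w , w<u , w⋠v) | yes (w′ , w′<v , w′⋠u) = ⊥-elim (no-2+2 (w<u , w′<v , w∥w′ , w∥v , u∥w′ , u∥v))
    where
    w∥w′ : w ∥ w′
    w∥w′ = (λ w≤w′ → w⋠v (≤ᴿ-trans w≤w′ (proj₁ w′<v))) , (λ w′≤w → w′⋠u (≤ᴿ-trans w′≤w (proj₁ w<u)))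
    w∥v : w ∥ v
    w∥v = w⋠v , (λ v≤w → proj₂ u∥v (≤ᴿ-trans v≤w (proj₁ w<u)))
    u∥w′ : u ∥ w′
    u∥w′ = (λ u≤w′ → proj₁ u∥v (≤ᴿ-trans u≤w′ (proj₁ w′<v))) , w′⋠u

  module _ {u v : Fin n} (u∥v : u ∥ v) (below-u : ∀ {w} → w <ᴿ u → w ≤ᴿ v) (below-v : ∀ {w} → w <ᴿ v → w ≤ᴿ u) where

    private
      below-u-below-rest : ∀ {i j} → i <ᴿ u → ¬ j <ᴿ u → i ≤ᴿ j
      below-u-below-rest {i} {j} i<u j≮u = by-colour (colour j 𝔹.≟ colour u)
        where
        via-u : j ≤ᴿ u → i ≤ᴿ j
        via-u j≤u = subst (i ≤ᴿ_) (sym (≤ᴿ-≮ᴿ⇒≡ j≤u j≮u)) (proj₁ i<u)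
        via-v : j ≤ᴿ v → i ≤ᴿ j
        via-v j≤v = [ (λ { refl → below-u i<u }) , via-u ∘ below-v ]′ (≤ᴿ⇒≡⊎<ᴿ j≤v)
        by-colour : Dec (colour j ≡ colour u) → i ≤ᴿ j
        by-colour (yes same) = [ via-u , ≤ᴿ-trans (proj₁ i<u) ]′ (same-colour⇒comparable same)
        by-colour (no differ) = [ via-v , ≤ᴿ-trans (below-u i<u) ]′
          (same-colour⇒comparable (trans (𝔹.¬-not differ) (sym (incomparable⇒colour-flips u∥v))))

      recolour : Fin n → Bool
      recolour i = not (does (strict? R i u)) xor colour i

      recolour-below : ∀ {i} → i <ᴿ u → recolour i ≡ colour i
      recolour-below {i} i<u = cong (λ b → not b xor colour i) (dec-true (strict? R i u) i<u)

      recolour-rest : ∀ {i} → ¬ i <ᴿ u → recolour i ≡ not (colour i)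
      recolour-rest {i} i≮u = cong (λ b → not b xor colour i) (dec-false (strict? R i u) i≮u)

      monochromatic : ∀ i j → recolour i ≡ recolour j → Comparable R i j
      monochromatic i j e with strict? R i u | strict? R j u
      ... | yes i<u | yes j<u =
        same-colour⇒comparable (trans (sym (recolour-below i<u)) (trans e (recolour-below j<u)))
      ... | no i≮u | no j≮u =
        same-colour⇒comparable (𝔹.not-injective (trans (sym (recolour-rest i≮u)) (trans e (recolour-rest j≮u))))
      ... | yes i<u | no j≮u = inj₁ (below-u-below-rest i<u j≮u)
      ... | no i≮u | yes j<u = inj₂ (below-u-below-rest j<u i≮u)

    -- Swapping the colours of the elements not strictly below u would give a second cover.
    lower-sets-differ : ¬ ∃ (_<ᴿ u)
    lower-sets-differ (w , w<u) with proj₂ unique _ _ A B (colourCover recolour monochromatic) cover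
    ... | inj₁ (e , _) = 𝔹.not-¬ refl (trans (tabulate-≡⇒lookup recolour e u) (recolour-rest (λ (_ , u≢u) → u≢u refl)))
    ... | inj₂ (_ , e) = 𝔹.not-¬ refl (trans (tabulate-≡⇒lookup (not ∘ recolour) e w) (cong not (recolour-below w<u)))

  same-deg⇒lower-sets-equal : ∀ {u v} → deg u ≡ deg v → (∀ {w} → w <ᴿ u → w ≤ᴿ v) → ∀ {w} → w <ᴿ v → w ≤ᴿ u
  same-deg⇒lower-sets-equal {u} {v} same below-u {w} w<v = ≤ᴿ-stable λ w⋠u →
    <-irrefl same (count-strict (λ x → strict? R x u) (λ x → strict? R x v) below-u⇒below-v w<v (w⋠u ∘ proj₁))
    where
    below-u⇒below-v : ∀ {x} → x <ᴿ u → x <ᴿ v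
    below-u⇒below-v x<u = below-u x<u , λ { refl → <-irrefl (sym same) (deg-mono x<u) }

  deg-injective : ∀ {u v} → 0 < deg u → deg u ≡ deg v → u ≡ v
  deg-injective {u} {v} 0<deg same with u ≟ v
  ... | yes u≡v = u≡v
  ... | no u≢v with comparable? u v
  ...   | inj₁ (inj₁ u≤v) = contradiction same (ℕₚ.<⇒≢ (deg-mono (u≤v , u≢v)))
  ...   | inj₁ (inj₂ v≤u) = contradiction (sym same) (ℕₚ.<⇒≢ (deg-mono (v≤u , u≢v ∘ sym)))
  ...   | inj₂ u∥v with nested u∥v
  ...     | inj₁ below-u =
    ⊥-elim (lower-sets-differ u∥v below-u (same-deg⇒lower-sets-equal same below-u) (deg>0⇒below 0<deg))
  ...     | inj₂ below-v =
    ⊥-elim (lower-sets-differ (incomparable-sym {R = R} u∥v) below-v (same-deg⇒lower-sets-equal (sym same) below-v)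
                              (deg>0⇒below (subst (0 <_) same 0<deg)))

  minimal⇒incomparable : ∀ {a b} → Minimal a → Minimal b → a ≢ b → a ∥ b
  minimal⇒incomparable {a} {b} a-min b-min a≢b =
    (λ a≤b → contradiction (subst (deg a <_) b-min (deg-mono (a≤b , a≢b))) λ ()) ,
    (λ b≤a → contradiction (subst (deg b <_) a-min (deg-mono (b≤a , a≢b ∘ sym))) λ ())

  at-most-two-minimal : ∀ {a b c} → Minimal a → Minimal b → Minimal c → a ≢ b → a ≢ c → b ≢ c → ⊥
  at-most-two-minimal a-min b-min c-min a≢b a≢c b≢c =
    𝔹.not-¬ (trans (incomparable⇒colour-flips (minimal⇒incomparable a-min b-min a≢b))
                   (sym (incomparable⇒colour-flips (minimal⇒incomparable a-min c-min a≢c))))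
            (incomparable⇒colour-flips (minimal⇒incomparable c-min b-min (b≢c ∘ sym)))

  module Positions (m : Fin n) (m-minimal : Minimal m) where

    position : Fin n → ℕ
    position z = place (deg z) ⌊ z ≟ m ⌋

    position<n : ∀ z → position z < n
    position<n z = place-bound (deg z) ⌊ z ≟ m ⌋ (deg-bound z)

    position-injective : ∀ {u v} → position u ≡ position v → u ≡ v
    position-injective {u} {v} e with place-injective (deg u) (deg v) ⌊ u ≟ m ⌋ ⌊ v ≟ m ⌋ e
    ... | inj₂ (same , 0<deg) = deg-injective 0<deg same
    ... | inj₁ (u-minimal , v-minimal , same-test) with u ≟ m | v ≟ m
    ...   | yes refl | yes refl = refl
    ...   | yes _ | no _ = contradiction same-test λ ()
    ...   | no _ | yes _ = contradiction same-test λ ()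
    ...   | no u≢m | no v≢m with u ≟ v
    ...     | yes u≡v = u≡v
    ...     | no u≢v = ⊥-elim (at-most-two-minimal u-minimal v-minimal m-minimal u≢v u≢m v≢m)

    private
      label : Fin n → Fin n
      label z = fromℕ< (position<n z)

      label-injective : ∀ {u v} → label u ≡ label v → u ≡ v
      label-injective e = position-injective (trans (sym (toℕ-fromℕ< _)) (trans (cong toℕ e) (toℕ-fromℕ< _)))

      labelling = injection⇒permutation label label-injective

    opaque
      σ : Permutation′ n
      σ = proj₁ labelling

      σ-label : ∀ z → σ ⟨$⟩ʳ z ≡ fromℕ< (position<n z)
      σ-label = proj₂ labelling

    toℕ-σ : ∀ z → toℕ (σ ⟨$⟩ʳ z) ≡ position z
    toℕ-σ z = trans (cong toℕ (σ-label z)) (toℕ-fromℕ< _)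

    element-at : ∀ {k} → k < n → ∃ λ w → position w ≡ k
    element-at k<n = σ ⟨$⟩ˡ fromℕ< k<n , trans (sym (toℕ-σ _)) (trans (cong toℕ (inverseʳ σ)) (toℕ-fromℕ< k<n))

    position-mono : ∀ {u v} → u <ᴿ v → position u < position v
    position-mono {u} {v} u<v = place-mono ⌊ u ≟ m ⌋ ⌊ v ≟ m ⌋ (deg-mono u<v)

    deg≡position∸1 : ∀ v → deg v ≡ position v ∸ 1
    deg≡position∸1 v = sym (place-∸1 (deg v) ⌊ v ≟ m ⌋)

    position-m : position m ≡ 0
    position-m = cong₂ place m-minimal (trans (isYes≗does (m ≟ m)) (dec-true (m ≟ m) refl))

    position≡⇒deg : ∀ {w k} → position w ≡ k → deg w ≡ k ∸ 1
    position≡⇒deg {w} w≡k = trans (deg≡position∸1 w) (cong (_∸ 1) w≡k)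

    position≡1 : ∀ {w} → position w ≡ 1 → Minimal w × w ≢ m
    position≡1 w≡1 = position≡⇒deg w≡1 , λ { refl → contradiction (trans (sym w≡1) position-m) λ () }

    position≡1⇒colour : ∀ {w} → position w ≡ 1 → colour w ≡ not (colour m)
    position≡1⇒colour w≡1 with position≡1 w≡1
    ... | w-minimal , w≢m = incomparable⇒colour-flips (minimal⇒incomparable m-minimal w-minimal (w≢m ∘ sym))

    count-position< : ∀ k → k ≤ n → count (λ w → position w <? k) ≡ k
    count-position< k k≤n = begin
      count (λ w → position w <? k)          ≡⟨ count-cong (λ w → position w <? k) (λ w → toℕ (σ ⟨$⟩ʳ w) <? k) by-σ ⟩
      count (λ w → toℕ (σ ⟨$⟩ʳ w) <? k)      ≡⟨ count-permute (λ (i : Fin n) → toℕ i <? k) σ ⟩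
      count (λ (i : Fin n) → toℕ i <? k)     ≡⟨ count-toℕ< k k≤n ⟩
      k                                      ∎
      where
      open ≡-Reasoning
      by-σ : ∀ w → position w < k ⇔ toℕ (σ ⟨$⟩ʳ w) < k
      by-σ w = mk⇔ (subst (_< k) (sym (toℕ-σ w))) (subst (_< k) (toℕ-σ w))

    module _ {v : Fin n} (0<position : 0 < position v) where

      private
        lower? = λ w → strict? R w v
        earlier? = λ w → position w <? position v

        count-lower : count lower? ≡ position v ∸ 1
        count-lower = deg≡position∸1 v

        count-earlier : count earlier? ≡ position v
        count-earlier = count-position< (position v) (<⇒≤ (position<n v))

        earlier⇒≢ : ∀ {p} → position p < position v → p ≢ v
        earlier⇒≢ p<v refl = <-irrefl refl p<v

        lower<earlier : count lower? < count earlier?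
        lower<earlier = subst₂ _<_ (sym count-lower) (sym count-earlier) (∸1< 0<position)
          where
          ∸1< : ∀ {x} → 0 < x → x ∸ 1 < x
          ∸1< (s≤s _) = ≤-refl

      earlier-not-below : ∃ λ p → position p < position v × ¬ p ≤ᴿ v
      earlier-not-below with count-gap lower? earlier? lower<earlier
      ... | p , p<v , p≮v = p , p<v , λ p≤v → p≮v (p≤v , earlier⇒≢ p<v)

      earlier-not-below-unique : ∀ {p p′} → position p < position v → ¬ p ≤ᴿ v →
                                 position p′ < position v → ¬ p′ ≤ᴿ v → p ≡ p′
      earlier-not-below-unique {p} {p′} p<v p⋠v p′<v p′⋠v with p ≟ p′
      ... | yes p≡p′ = p≡p′
      ... | no p≢p′ =
        contradiction (count-two-gaps lower? earlier? position-mono p≢p′ p<v (p⋠v ∘ proj₁) p′<v (p′⋠v ∘ proj₁))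
                      (subst₂ (λ a b → ¬ 2 + a ≤ b) (sym count-lower) (sym count-earlier)
                              (two-gaps-impossible (position v)))
        where
        two-gaps-impossible : ∀ x → ¬ 2 + (x ∸ 1) ≤ x
        two-gaps-impossible zero ()
        two-gaps-impossible (suc x) (s≤s x+1≤x) = <-irrefl refl x+1≤x

    module Relabel (paint : Fin n → Bool) (same-paint⇒comparable : ∀ {u v} → paint u ≡ paint v → Comparable R u v)
                   (incomparable⇒paint-differs : ∀ {u v} → u ∥ v → paint u ≢ paint v) where

      -- Positions beyond n get the junk colour false.
      paintAt : ∀ k → Dec (k < n) → Bool
      paintAt k (yes k<n) = paint (σ ⟨$⟩ˡ fromℕ< k<n)
      paintAt k (no _) = false

      τ : ℕ → Bool
      τ k = paintAt k (k <? n)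

      τ-position : ∀ w → τ (position w) ≡ paint w
      τ-position w =
        trans (paintAt-yes (position w <? n)) (cong paint (trans (cong (σ ⟨$⟩ˡ_) (sym (σ-label w))) (inverseˡ σ)))
        where
        paintAt-yes : (d : Dec (position w < n)) → paintAt (position w) d ≡ paint (σ ⟨$⟩ˡ fromℕ< (position<n w))
        paintAt-yes (yes _) = refl
        paintAt-yes (no w≮n) = contradiction (position<n w) w≮n

      private
        same-paint⇒≤ᴿ : ∀ {u v} → paint u ≡ paint v → position u ≤ position v → u ≤ᴿ v
        same-paint⇒≤ᴿ {u} {v} same u≤v =
          [ id , (λ v≤u → [ (λ { refl → ≤ᴿ-refl v }) , (λ v<u → contradiction (position-mono v<u) (≤⇒≯ u≤v)) ]′
                            (≤ᴿ⇒≡⊎<ᴿ v≤u)) ]′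
            (same-paint⇒comparable same)

        earlier-not-below-paint : ∀ {u v p} → paint u ≢ paint v → position p < position v → ¬ p ≤ᴿ v →
                                  paint p ≡ paint u
        earlier-not-below-paint {u} {v} {p} differ p<v p⋠v =
          trans (𝔹.¬-not (incomparable⇒paint-differs (p⋠v , v⋠p))) (sym (𝔹.¬-not differ))
          where
          v⋠p : ¬ v ≤ᴿ p
          v⋠p v≤p = [ (λ { refl → <-irrefl refl p<v }) , (λ v<p → <-asym p<v (position-mono v<p)) ]′ (≤ᴿ⇒≡⊎<ᴿ v≤p)

      ≤ᴿ⇒≼ : ∀ {u v} → u ≤ᴿ v → position u ≼[ τ ] position v
      ≤ᴿ⇒≼ {u} {v} u≤v with ≤ᴿ⇒≡⊎<ᴿ u≤v | paint u 𝔹.≟ paint v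
      ... | inj₁ refl | _ = inj₁ refl
      ... | inj₂ u<v | yes same = inj₂ (position v , position-mono u<v , ≤-refl ,
                                         trans (τ-position v) (trans (sym same) (sym (τ-position u))))
      ... | inj₂ u<v | no differ with earlier-not-below {v} (≤-<-trans z≤n (position-mono u<v))
      ...   | p , p<v , p⋠v with <-cmp (position u) (position p)
      ...     | tri< u<p _ _ =
        inj₂ (position p , u<p , <⇒≤ p<v ,
              trans (τ-position p) (trans (earlier-not-below-paint differ p<v p⋠v) (sym (τ-position u))))
      ...     | tri≈ _ u≈p _ = contradiction (subst (_≤ᴿ v) (position-injective u≈p) u≤v) p⋠v
      ...     | tri> _ _ p<u =
        contradiction (≤ᴿ-trans (same-paint⇒≤ᴿ (earlier-not-below-paint differ p<v p⋠v) (<⇒≤ p<u)) u≤v) p⋠v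

      ≼⇒≤ᴿ : ∀ {u v} → position u ≼[ τ ] position v → u ≤ᴿ v
      ≼⇒≤ᴿ {u} {v} (inj₁ same) = subst (u ≤ᴿ_) (position-injective same) (≤ᴿ-refl u)
      ≼⇒≤ᴿ {u} {v} (inj₂ (k , u<k , k≤v , τk≡τu)) = ≤ᴿ-stable λ u⋠v →
        let w⋠v : ¬ w ≤ᴿ v
            w⋠v w≤v = u⋠v (≤ᴿ-trans u≤w w≤v)
            w<v : position w < position v
            w<v = ≤∧≢⇒< (subst (_≤ position v) (sym w≡k) k≤v)
                        (λ e → w⋠v (subst (w ≤ᴿ_) (position-injective e) (≤ᴿ-refl w)))
            u<v = <-≤-trans u<k k≤v
        in <-irrefl (trans (cong position (earlier-not-below-unique (≤-<-trans z≤n u<v) u<v u⋠v w<v w⋠v)) w≡k) u<k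
        where
        w = proj₁ (element-at (≤-<-trans k≤v (position<n v)))
        w≡k = proj₂ (element-at (≤-<-trans k≤v (position<n v)))
        u≤w : u ≤ᴿ w
        u≤w = same-paint⇒≤ᴿ (trans (sym (τ-position u)) (trans (sym τk≡τu) (trans (cong τ (sym w≡k)) (τ-position w))))
                           (subst (position u ≤_) (sym w≡k) (<⇒≤ u<k))

      relabel : ∀ u v → R u v ≡ canonical τ (σ ⟨$⟩ʳ u) (σ ⟨$⟩ʳ v)
      relabel u v = trans (does-⇔ (mk⇔ (at-σ ∘ ≤ᴿ⇒≼) (≼⇒≤ᴿ ∘ from-σ)) (T? (R u v)) (≼-dec τ _ _))
                           (sym (isYes≗does (≼-dec τ _ _)))
        where
        at-σ : position u ≼[ τ ] position v → toℕ (σ ⟨$⟩ʳ u) ≼[ τ ] toℕ (σ ⟨$⟩ʳ v)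
        at-σ = subst₂ (_≼[ τ ]_) (sym (toℕ-σ u)) (sym (toℕ-σ v))
        from-σ : toℕ (σ ⟨$⟩ʳ u) ≼[ τ ] toℕ (σ ⟨$⟩ʳ v) → position u ≼[ τ ] position v
        from-σ = subst₂ (_≼[ τ ]_) (toℕ-σ u) (toℕ-σ v)

  -- Choosing m of the same colour as the element of down-degree 1 makes the relabelled word start 1 0 1.
  module Completeness (3≤n : 3 ≤ n) (m : Fin n) (m-minimal : Minimal m) (e₂ : Fin n) (deg-e₂ : deg e₂ ≡ 1)
                      (m-colour : colour m ≡ colour e₂) where

    open Positions m m-minimal

    paint : Fin n → Bool
    paint z = does (colour z 𝔹.≟ colour m)

    paint-flips : ∀ {u v} → u ∥ v → paint u ≢ paint v
    paint-flips {u} {v} u∥v =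
      does-≟-not (colour u) (colour m) ∘ subst (λ c → _ ≡ does (c 𝔹.≟ colour m)) (incomparable⇒colour-flips u∥v)

    open Relabel paint (same-colour⇒comparable ∘ does-≟-injective) paint-flips

    τ-at : ∀ w {k} → position w ≡ k → τ k ≡ paint w
    τ-at w refl = τ-position w

    τ0 : τ 0 ≡ true
    τ0 = trans (τ-at m position-m) (dec-true (colour m 𝔹.≟ colour m) refl)

    τ1 : τ 1 ≡ false
    τ1 with element-at (≤-trans (s≤s (s≤s z≤n)) 3≤n)
    ... | w , w≡1 =
      trans (τ-at w w≡1) (dec-false (colour w 𝔹.≟ colour m) (𝔹.not-¬ refl ∘ sym ∘ trans (sym (position≡1⇒colour w≡1))))

    τ2 : τ 2 ≡ true
    τ2 with element-at 3≤n
    ... | w , w≡2 =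
      trans (τ-at w w≡2) (dec-true (colour w 𝔹.≟ colour m) (trans (cong colour w≡e₂) (sym m-colour)))
      where
      deg-w = position≡⇒deg w≡2
      w≡e₂ : w ≡ e₂
      w≡e₂ = deg-injective (subst (0 <_) (sym deg-w) (s≤s z≤n)) (trans deg-w (sym deg-e₂))

    bits : Vec Bool (n ∸ 3)
    bits = prefix (τ ∘ (3 +_)) (n ∸ 3)

    τ≗word : ∀ k → k < n → τ k ≡ word bits k
    τ≗word 0 _ = τ0
    τ≗word 1 _ = τ1
    τ≗word 2 _ = τ2
    τ≗word (suc (suc (suc k))) 3+k<n =
      sym (!-prefix (τ ∘ (3 +_)) (+-cancelˡ-< 3 k (n ∸ 3) (subst (3 + k <_) (sym (m+[n∸m]≡n 3≤n)) 3+k<n)))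

    isomorphic : Isomorphic R (family n bits)
    isomorphic = σ , λ i j → trans (relabel i j) (canonical-cong τ≗word (σ ⟨$⟩ʳ i) (σ ⟨$⟩ʳ j))

  complete : 3 ≤ n → ∃ λ (v : Vec Bool (n ∸ 3)) → Isomorphic R (family n v)
  complete 3≤n with minimal-below (fromℕ< (≤-trans (s≤s z≤n) 3≤n)) (ℕ.<-wellFounded _)
  ... | m₀ , m₀-minimal = by-colour (element-at 3≤n) (element-at (≤-trans (s≤s (s≤s z≤n)) 3≤n))
    where
    open Positions m₀ m₀-minimal
    by-colour : ∃ (λ w → position w ≡ 2) → ∃ (λ w → position w ≡ 1) → ∃ λ v → Isomorphic R (family n v)
    by-colour (e₂ , e₂≡2) (m₁ , m₁≡1) with colour m₀ 𝔹.≟ colour e₂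
    ... | yes same = _ , Completeness.isomorphic 3≤n m₀ m₀-minimal e₂ (position≡⇒deg e₂≡2) same
    ... | no differ = _ , Completeness.isomorphic 3≤n m₁ (proj₁ (position≡1 m₁≡1)) e₂ (position≡⇒deg e₂≡2)
                                                  (trans (position≡1⇒colour m₁≡1) (sym (𝔹.¬-not (differ ∘ sym))))

proposition3p4 : (n : ℕ) → 3 ≤ n →
    Σ (List (Rel n)) λ L →
      length L ≡ 2 ^ (n ∸ 3) ×
      All IsTwoChain L ×
      AllPairs (λ R S → ¬ Isomorphic R S) L ×
      (∀ (R : Rel n) → IsTwoChain R → Any (Isomorphic R) L)
proposition3p4 n 3≤n =
  map (family n) (vectors (n ∸ 3)) ,
  trans (length-map (family n) (vectors (n ∸ 3))) (length-vectors (n ∸ 3)) ,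
  All.map⁺ (All.universal (family-isTwoChain n 3≤n) (vectors (n ∸ 3))) ,
  AllPairs.map⁺ (AllPairs.map (λ {v} {w} v≢w → v≢w ∘ family-injective n 3≤n v w) (vectors-distinct (n ∸ 3))) ,
  λ R twoChain → let bits , R≅bits = TwoChainStructure.complete R twoChain 3≤n in
                 Any.map⁺ (Any.map (λ { refl → R≅bits }) (∈-vectors bits))
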